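{- Let $a,b$ be positive integers. Let $p_{n,\ell}^{(a,b)}$ be the total number of peaks at level $\ell+1$ over all colored $(a,b)$-Dyck paths of length $2n+2$. Then for all integers $n\ge\ell\ge0$, $$p_{n,\ell}^{(a,b)}=\sum_{j=0}^{n-\ell}\frac{2a(\ell+1)}{2n-j+2}\binom{2n-j+2}{n-\ell}\binom{n-\ell}{j}(a-b)^{j}b^{n-j},$$ with $p_{0,0}^{(a,b)}=a$. Moreover, $p_{n,\ell}^{(a,b)}$ is the $(n,\ell)$-entry of the Riordan array $\left(aC(a,b;x)^2,\ bxC(a,b;x)^2\right)$, i.e. $p_{n,\ell}^{(a,b)}=[x^n]\,aC(a,b;x)^2\left(bxC(a,b;x)^2\right)^{\ell}$.
   Context: A Dyck path of length $2n$ is a lattice path from $(0,0)$ to $(2n,0)$ weakly above the $x$-axis with steps $\mathbf{u}=(1,1)$, $\mathbf{d}=(1,-1)$. A colored $(a,b)$-Dyck path is a Dyck path in which each $\mathbf{d}$-step that is part of a peak (i.e. immediately preceded by a $\mathbf{u}$-step) is colored with one of $a$ colors and every other $\mathbf{d}$-step is colored with one of $b$ colors. A peak is a $\mathbf{u}$-step immediately followed by a $\mathbf{d}$-step; its level is the ordinate of the common point. $C(a,b;x)=\frac{1-(a-b)x-\sqrt{(1-(a-b)x)^2-4bx}}{2bx}$ is the unique power series with $C=1+(a-b)xC+bxC^2$. A Riordan array $(d(x),h(x))$ has $(n,k)$-entry $[x^n]d(x)h(x)^k$. -}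

module Defs where

open import Data.Bool using (Bool; T?; true; false; _∧_; if_then_else_)
open import Data.Nat as N using (ℕ; zero; suc; _∸_; _⊔_; _≡ᵇ_; _<ᵇ_)
open import Data.Nat.Combinatorics using (_C_)
open import Data.List using (List; []; _∷_; map; concatMap; upTo; filter; foldr)
open import Data.Nat.ListAction using (sum)
open import Data.Integer as ℤ using (ℤ; +_)
open import Data.Rational as ℚ using (ℚ; 0ℚ)
open import Relation.Binary.PropositionalEquality using (_≡_)

-- A step is an up-step u, or a down-step d carrying a color (a natural
-- number; the validity check below bounds it by a or b).
data Step : Set where
  U : Step
  D : ℕ → Step

-- validFrom a b h s : the remaining steps s, starting at height h, never
-- go below the x-axis, end at height 0, every d-step immediately preceded
-- by a u-step (peak d-step) has color < a, and every other d-step has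
-- color < b.
validFrom : ℕ → ℕ → ℕ → Bool → List Step → Bool
validFrom a b h       _     []          = h ≡ᵇ 0
validFrom a b h       _     (U ∷ s)     = validFrom a b (suc h) true s
validFrom a b zero    _     (D c ∷ s)   = false
validFrom a b (suc h) true  (D c ∷ s)   = (c <ᵇ a) ∧ validFrom a b h false s
validFrom a b (suc h) false (D c ∷ s)   = (c <ᵇ b) ∧ validFrom a b h false s

isColoredDyck : ℕ → ℕ → List Step → Bool
isColoredDyck a b s = validFrom a b 0 false s

alphabet : ℕ → ℕ → List Step
alphabet a b = U ∷ map D (upTo (a ⊔ b))

words : ℕ → ℕ → ℕ → List (List Step)
words a b zero    = [] ∷ []
words a b (suc m) = concatMap (λ w → map (λ x → x ∷ w) (alphabet a b)) (words a b m)

coloredDyckPaths : ℕ → ℕ → ℕ → List (List Step)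
coloredDyckPaths a b m = filter (λ s → T? (isColoredDyck a b s)) (words a b m)

startsWithD : List Step → Bool
startsWithD (D _ ∷ _) = true
startsWithD _         = false

-- number of peaks at level k of a path (current height h): a u-step
-- immediately followed by a d-step whose common point has ordinate k
peaksAtFrom : ℕ → ℕ → List Step → ℕ
peaksAtFrom k h []        = 0
peaksAtFrom k h (U ∷ s)   =
  (if startsWithD s ∧ (suc h ≡ᵇ k) then 1 else 0) N.+ peaksAtFrom k (suc h) s
peaksAtFrom k h (D _ ∷ s) = peaksAtFrom k (h ∸ 1) s

peaksAt : ℕ → List Step → ℕ
peaksAt k s = peaksAtFrom k 0 s

p : ℕ → ℕ → ℕ → ℕ → ℕ
p a b n ℓ = sum (map (peaksAt (suc ℓ)) (coloredDyckPaths a b (2 N.* n N.+ 2)))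

formulaTerm : ℕ → ℕ → ℕ → ℕ → ℕ → ℚ
formulaTerm a b n ℓ j =
  (+ (2 N.* a N.* suc ℓ) ℤ.* + (M C (n ∸ ℓ)) ℤ.* + ((n ∸ ℓ) C j)
     ℤ.* (((+ a) ℤ.- (+ b)) ℤ.^ j) ℤ.* ((+ b) ℤ.^ (n ∸ j)))
  ℚ./ M
  where M = suc (suc (2 N.* n ∸ j))   -- = 2n - j + 2, since j ≤ n

formula : ℕ → ℕ → ℕ → ℕ → ℚ
formula a b n ℓ = foldr ℚ._+_ 0ℚ (map (formulaTerm a b n ℓ) (upTo (suc (n ∸ ℓ))))

Series : Set
Series = ℕ → ℤ

sumTo : ℕ → (ℕ → ℤ) → ℤ
sumTo n f = foldr ℤ._+_ (+ 0) (map f (upTo (suc n)))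

_⊛_ : Series → Series → Series
(f ⊛ g) n = sumTo n (λ i → f i ℤ.* g (n ∸ i))

xS : Series → Series
xS f zero    = + 0
xS f (suc n) = f n

scale : ℤ → Series → Series
scale c f n = c ℤ.* f n

oneS : Series
oneS zero    = + 1
oneS (suc _) = + 0

_⊕_ : Series → Series → Series
(f ⊕ g) n = f n ℤ.+ g n

powS : Series → ℕ → Series
powS f zero    = oneS
powS f (suc k) = f ⊛ powS f k

-- C is C(a,b;x): C = 1 + (a-b) x C + b x C², coefficientwise
-- (this equation determines C uniquely).
IsCab : ℕ → ℕ → Series → Set
IsCab a b C = ∀ n → C n ≡ (oneS ⊕ (scale (+ a ℤ.- + b) (xS C) ⊕ scale (+ b) (xS (C ⊛ C)))) n

riordanEntry : Series → Series → ℕ → ℕ → ℤ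
riordanEntry d h n k = (d ⊛ powS h k) n

-- Reading a colored path step by step, keeping its height and whether the last step was u,
-- gives linear recurrences in the length for the number of paths down to the axis and for
-- their total number of peaks at level ℓ+1.  Both are solved in closed form through the
-- coefficients of the powers of C = C(a,b;x); from height 0 the peak total is
-- a·b^ℓ·[x^(n-ℓ)] C^(2ℓ+2).  Since (bxC²)^ℓ = b^ℓ x^ℓ C^(2ℓ), this is the Riordan entry.
-- Expanding [x^N] C^r as a polynomial in a-b and b, the coefficient of (a-b)^j b^m
-- (j + m = N) is r/K·C(K,N)·C(N,j) with K = r+j+2m, which for r = 2ℓ+2 gives the explicit sum.

module Submission where

open import Defs

open import Data.Nat using (ℕ; zero; suc; _∸_; _≤_; _<_; z≤n; s≤s)
import Data.Nat as ℕ using (_+_; _*_)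
import Data.Nat.Properties as ℕ
open import Function using (_∘_)
open import Relation.Binary.PropositionalEquality
open ≡-Reasoning

module FiniteSums where
  open import Data.Bool using (if_then_else_)
  open import Data.Integer using (ℤ; +_; _+_; _*_; _-_)
  import Data.Integer.Properties as ℤ
  open import Data.Integer.Tactic.RingSolver using (solve-∀)
  open import Data.List using (map; applyUpTo; foldr)
  open import Data.Nat using (_≡ᵇ_; _<ᵇ_)

  ∑ : ℕ → (ℕ → ℤ) → ℤ
  ∑ zero    f = + 0
  ∑ (suc n) f = f 0 + ∑ n (f ∘ suc)

  ∑-cong : ∀ n {f g : ℕ → ℤ} → (∀ i → i < n → f i ≡ g i) → ∑ n f ≡ ∑ n g
  ∑-cong zero    eq = refl
  ∑-cong (suc n) eq = cong₂ _+_ (eq 0 (s≤s z≤n)) (∑-cong n (λ i i<n → eq (suc i) (s≤s i<n)))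

  ∑-zero : ∀ n {f : ℕ → ℤ} → (∀ i → i < n → f i ≡ + 0) → ∑ n f ≡ + 0
  ∑-zero zero    eq = refl
  ∑-zero (suc n) eq = cong₂ _+_ (eq 0 (s≤s z≤n)) (∑-zero n (λ i i<n → eq (suc i) (s≤s i<n)))

  ∑-distrib-+ : ∀ n (f g : ℕ → ℤ) → ∑ n (λ i → f i + g i) ≡ ∑ n f + ∑ n g
  ∑-distrib-+ zero    f g = refl
  ∑-distrib-+ (suc n) f g = begin
    f 0 + g 0 + ∑ n (λ i → f (suc i) + g (suc i))  ≡⟨ cong (_+_ (f 0 + g 0)) (∑-distrib-+ n (f ∘ suc) (g ∘ suc)) ⟩
    f 0 + g 0 + (∑ n (f ∘ suc) + ∑ n (g ∘ suc))    ≡⟨ interchange (f 0) (g 0) _ _ ⟩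
    f 0 + ∑ n (f ∘ suc) + (g 0 + ∑ n (g ∘ suc))    ∎
    where
    interchange : ∀ w x y z → w + x + (y + z) ≡ w + y + (x + z)
    interchange = solve-∀

  ∑-distrib-- : ∀ n (f g : ℕ → ℤ) → ∑ n (λ i → f i - g i) ≡ ∑ n f - ∑ n g
  ∑-distrib-- zero    f g = refl
  ∑-distrib-- (suc n) f g = begin
    f 0 - g 0 + ∑ n (λ i → f (suc i) - g (suc i))  ≡⟨ cong (_+_ (f 0 - g 0)) (∑-distrib-- n (f ∘ suc) (g ∘ suc)) ⟩
    f 0 - g 0 + (∑ n (f ∘ suc) - ∑ n (g ∘ suc))    ≡⟨ interchange (f 0) (g 0) _ _ ⟩
    f 0 + ∑ n (f ∘ suc) - (g 0 + ∑ n (g ∘ suc))    ∎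
    where
    interchange : ∀ w x y z → w - x + (y - z) ≡ w + y - (x + z)
    interchange = solve-∀

  *-distribˡ-∑ : ∀ n c (f : ℕ → ℤ) → c * ∑ n f ≡ ∑ n (λ i → c * f i)
  *-distribˡ-∑ zero    c f = ℤ.*-zeroʳ c
  *-distribˡ-∑ (suc n) c f = trans (ℤ.*-distribˡ-+ c (f 0) _) (cong (_+_ (c * f 0)) (*-distribˡ-∑ n c (f ∘ suc)))

  ∑-init-last : ∀ n (f : ℕ → ℤ) → ∑ (suc n) f ≡ ∑ n f + f n
  ∑-init-last zero    f = trans (ℤ.+-identityʳ (f 0)) (sym (ℤ.+-identityˡ (f 0)))
  ∑-init-last (suc n) f = trans (cong (_+_ (f 0)) (∑-init-last n (f ∘ suc))) (sym (ℤ.+-assoc (f 0) _ _))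

  ∑-select : ∀ n h (f : ℕ → ℤ) → ∑ n (λ i → if i ≡ᵇ h then f i else + 0) ≡ (if h <ᵇ n then f h else + 0)
  ∑-select zero    h       f = refl
  ∑-select (suc n) zero    f = trans (cong (_+_ (f 0)) (∑-zero n (λ _ _ → refl))) (ℤ.+-identityʳ (f 0))
  ∑-select (suc n) (suc h) f = trans (ℤ.+-identityˡ _) (∑-select n h (f ∘ suc))

  sumTo≡∑ : ∀ n f → sumTo n f ≡ ∑ (suc n) f
  sumTo≡∑ n f = foldr-applyUpTo (suc n) (λ i → i)
    where
    foldr-applyUpTo : ∀ m (g : ℕ → ℕ) → foldr _+_ (+ 0) (map f (applyUpTo g m)) ≡ ∑ m (f ∘ g)
    foldr-applyUpTo zero    g = refl
    foldr-applyUpTo (suc m) g = cong (_+_ (f (g 0))) (foldr-applyUpTo m (g ∘ suc))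

open FiniteSums

module PowerSeries where
  open import Data.Integer using (ℤ; +_; _+_; _*_)
  import Data.Integer.Properties as ℤ
  open import Data.Integer.Tactic.RingSolver using (solve-∀)

  infix 4 _≈_
  _≈_ : Series → Series → Set
  f ≈ g = ∀ n → f n ≡ g n

  tailS : Series → Series
  tailS f = f ∘ suc

  ⊛≡∑ : ∀ f g n → (f ⊛ g) n ≡ ∑ (suc n) (λ i → f i * g (n ∸ i))
  ⊛≡∑ f g n = sumTo≡∑ n (λ i → f i * g (n ∸ i))

  ⊛-congˡ : ∀ {f f′} g → f ≈ f′ → f ⊛ g ≈ f′ ⊛ g
  ⊛-congˡ {f} {f′} g f≈f′ n = begin
    (f ⊛ g) n                            ≡⟨ ⊛≡∑ f g n ⟩
    ∑ (suc n) (λ i → f i * g (n ∸ i))    ≡⟨ ∑-cong (suc n) (λ i _ → cong (_* g (n ∸ i)) (f≈f′ i)) ⟩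
    ∑ (suc n) (λ i → f′ i * g (n ∸ i))   ≡⟨ ⊛≡∑ f′ g n ⟨
    (f′ ⊛ g) n                           ∎

  ⊛-congʳ : ∀ f {g g′} → g ≈ g′ → f ⊛ g ≈ f ⊛ g′
  ⊛-congʳ f {g} {g′} g≈g′ n = begin
    (f ⊛ g) n                            ≡⟨ ⊛≡∑ f g n ⟩
    ∑ (suc n) (λ i → f i * g (n ∸ i))    ≡⟨ ∑-cong (suc n) (λ i _ → cong (f i *_) (g≈g′ (n ∸ i))) ⟩
    ∑ (suc n) (λ i → f i * g′ (n ∸ i))   ≡⟨ ⊛≡∑ f g′ n ⟨
    (f ⊛ g′) n                           ∎

  ⊛-head-tail : ∀ f g → f ⊛ g ≈ scale (f 0) g ⊕ xS (tailS f ⊛ g)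
  ⊛-head-tail f g zero    = ⊛≡∑ f g 0
  ⊛-head-tail f g (suc n) = trans (⊛≡∑ f g (suc n)) (cong (_+_ (f 0 * g (suc n))) (sym (⊛≡∑ (tailS f) g n)))

  ⊛-distribʳ-⊕ : ∀ f g h → (f ⊕ g) ⊛ h ≈ (f ⊛ h) ⊕ (g ⊛ h)
  ⊛-distribʳ-⊕ f g h n = begin
    ((f ⊕ g) ⊛ h) n
      ≡⟨ ⊛≡∑ (f ⊕ g) h n ⟩
    ∑ (suc n) (λ i → (f i + g i) * h (n ∸ i))
      ≡⟨ ∑-cong (suc n) (λ i _ → ℤ.*-distribʳ-+ (h (n ∸ i)) (f i) (g i)) ⟩
    ∑ (suc n) (λ i → f i * h (n ∸ i) + g i * h (n ∸ i))
      ≡⟨ ∑-distrib-+ (suc n) (λ i → f i * h (n ∸ i)) (λ i → g i * h (n ∸ i)) ⟩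
    ∑ (suc n) (λ i → f i * h (n ∸ i)) + ∑ (suc n) (λ i → g i * h (n ∸ i))
      ≡⟨ cong₂ _+_ (⊛≡∑ f h n) (⊛≡∑ g h n) ⟨
    ((f ⊛ h) ⊕ (g ⊛ h)) n
      ∎

  ⊛-scaleˡ : ∀ c f g → scale c f ⊛ g ≈ scale c (f ⊛ g)
  ⊛-scaleˡ c f g n = begin
    (scale c f ⊛ g) n                          ≡⟨ ⊛≡∑ (scale c f) g n ⟩
    ∑ (suc n) (λ i → c * f i * g (n ∸ i))      ≡⟨ ∑-cong (suc n) (λ i _ → ℤ.*-assoc c (f i) (g (n ∸ i))) ⟩
    ∑ (suc n) (λ i → c * (f i * g (n ∸ i)))    ≡⟨ *-distribˡ-∑ (suc n) c (λ i → f i * g (n ∸ i)) ⟨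
    c * ∑ (suc n) (λ i → f i * g (n ∸ i))      ≡⟨ cong (c *_) (⊛≡∑ f g n) ⟨
    scale c (f ⊛ g) n                          ∎

  ⊛-scaleʳ : ∀ c f g → f ⊛ scale c g ≈ scale c (f ⊛ g)
  ⊛-scaleʳ c f g n = begin
    (f ⊛ scale c g) n                          ≡⟨ ⊛≡∑ f (scale c g) n ⟩
    ∑ (suc n) (λ i → f i * (c * g (n ∸ i)))    ≡⟨ ∑-cong (suc n) (λ i _ → swap (f i) c (g (n ∸ i))) ⟩
    ∑ (suc n) (λ i → c * (f i * g (n ∸ i)))    ≡⟨ *-distribˡ-∑ (suc n) c (λ i → f i * g (n ∸ i)) ⟨
    c * ∑ (suc n) (λ i → f i * g (n ∸ i))      ≡⟨ cong (c *_) (⊛≡∑ f g n) ⟨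
    scale c (f ⊛ g) n                          ∎
    where
    swap : ∀ x y z → x * (y * z) ≡ y * (x * z)
    swap = solve-∀

  ⊛-xSˡ : ∀ f g → xS f ⊛ g ≈ xS (f ⊛ g)
  ⊛-xSˡ f g zero    = ⊛-head-tail (xS f) g zero
  ⊛-xSˡ f g (suc n) = trans (⊛-head-tail (xS f) g (suc n)) (ℤ.+-identityˡ _)

  ⊛-xSʳ : ∀ f g → f ⊛ xS g ≈ xS (f ⊛ g)
  ⊛-xSʳ f g zero    = trans (⊛-head-tail f (xS g) zero) (trans (ℤ.+-identityʳ _) (ℤ.*-zeroʳ (f 0)))
  ⊛-xSʳ f g (suc n) = begin
    (f ⊛ xS g) (suc n)                ≡⟨ ⊛-head-tail f (xS g) (suc n) ⟩
    f 0 * g n + (tailS f ⊛ xS g) n    ≡⟨ cong (_+_ (f 0 * g n)) (⊛-xSʳ (tailS f) g n) ⟩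
    f 0 * g n + xS (tailS f ⊛ g) n    ≡⟨ ⊛-head-tail f g n ⟨
    (f ⊛ g) n                         ∎

  ⊛-identityˡ : ∀ g → oneS ⊛ g ≈ g
  ⊛-identityˡ g zero    = trans (⊛-head-tail oneS g zero) (trans (ℤ.+-identityʳ _) (ℤ.*-identityˡ _))
  ⊛-identityˡ g (suc n) = begin
    (oneS ⊛ g) (suc n)                 ≡⟨ ⊛-head-tail oneS g (suc n) ⟩
    + 1 * g (suc n) + (tailS oneS ⊛ g) n ≡⟨ cong₂ _+_ (ℤ.*-identityˡ (g (suc n))) (⊛-zeroˡ n) ⟩
    g (suc n) + + 0                    ≡⟨ ℤ.+-identityʳ _ ⟩
    g (suc n)                          ∎
    where
    ⊛-zeroˡ : (λ _ → + 0) ⊛ g ≈ (λ _ → + 0)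
    ⊛-zeroˡ n = trans (⊛≡∑ (λ _ → + 0) g n) (∑-zero (suc n) (λ _ _ → refl))

  ⊛-assoc : ∀ f g h → (f ⊛ g) ⊛ h ≈ f ⊛ (g ⊛ h)
  ⊛-assoc f g h n = begin
    ((f ⊛ g) ⊛ h) n
      ≡⟨ ⊛-congˡ h (⊛-head-tail f g) n ⟩
    ((scale (f 0) g ⊕ xS (tailS f ⊛ g)) ⊛ h) n
      ≡⟨ ⊛-distribʳ-⊕ (scale (f 0) g) (xS (tailS f ⊛ g)) h n ⟩
    (scale (f 0) g ⊛ h) n + (xS (tailS f ⊛ g) ⊛ h) n
      ≡⟨ cong₂ _+_ (⊛-scaleˡ (f 0) g h n) (⊛-xSˡ (tailS f ⊛ g) h n) ⟩
    f 0 * (g ⊛ h) n + xS ((tailS f ⊛ g) ⊛ h) n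
      ≡⟨ cong (_+_ (f 0 * (g ⊛ h) n)) (shifted-assoc n) ⟩
    f 0 * (g ⊛ h) n + xS (tailS f ⊛ (g ⊛ h)) n
      ≡⟨ ⊛-head-tail f (g ⊛ h) n ⟨
    (f ⊛ (g ⊛ h)) n
      ∎
    where
    shifted-assoc : xS ((tailS f ⊛ g) ⊛ h) ≈ xS (tailS f ⊛ (g ⊛ h))
    shifted-assoc zero    = refl
    shifted-assoc (suc m) = ⊛-assoc (tailS f) g h m

  xS^ : ℕ → Series → Series
  xS^ zero    f = f
  xS^ (suc k) f = xS^ k (xS f)

  xS^-cong : ∀ k {f g} → f ≈ g → xS^ k f ≈ xS^ k g
  xS^-cong zero    f≈g = f≈g
  xS^-cong (suc k) {f} {g} f≈g = xS^-cong k {xS f} {xS g} λ { zero → refl ; (suc n) → f≈g n }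

  xS^-scale : ∀ k c f → xS^ k (scale c f) ≈ scale c (xS^ k f)
  xS^-scale zero    c f n = refl
  xS^-scale (suc k) c f n =
    trans (xS^-cong k {xS (scale c f)} {scale c (xS f)} (λ { zero → sym (ℤ.*-zeroʳ c) ; (suc m) → refl }) n)
          (xS^-scale k c (xS f) n)

  ⊛-xS^ʳ : ∀ k f g → f ⊛ xS^ k g ≈ xS^ k (f ⊛ g)
  ⊛-xS^ʳ zero    f g n = refl
  ⊛-xS^ʳ (suc k) f g n = trans (⊛-xS^ʳ k f (xS g) n) (xS^-cong k (⊛-xSʳ f g) n)

  xS^-+ : ∀ k t f → xS^ k f (k ℕ.+ t) ≡ f t
  xS^-+ zero    t f = refl
  xS^-+ (suc k) t f = trans (cong (xS^ k (xS f)) (sym (ℕ.+-suc k t))) (xS^-+ k (suc t) (xS f))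

open PowerSeries

double : ℕ → ℕ
double zero    = zero
double (suc n) = suc (suc (double n))

double≡+ : ∀ n → double n ≡ n ℕ.+ n
double≡+ zero    = refl
double≡+ (suc n) = cong suc (trans (cong suc (double≡+ n)) (sym (ℕ.+-suc n n)))

module Coefficients (a b : ℕ) where
  open import Data.Integer using (ℤ; +_; _+_; _*_; _-_; _^_)
  import Data.Integer.Properties as ℤ
  open import Data.Integer.Tactic.RingSolver using (solve-∀)

  δ β : ℤ
  δ = + a - + b
  β = + b

  -- cpow r (double N) is [x^N] C(a,b;x)^r (powS-C≡cpow) and cpow r vanishes at odd
  -- arguments: it is indexed by path length, so that the peak count can use it directly.
  cpow : ℕ → ℕ → ℤ
  cpow r       zero          = + 1
  cpow r       (suc zero)    = + 0
  cpow zero    (suc (suc m)) = + 0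
  cpow (suc r) (suc (suc m)) = cpow r (suc (suc m)) + δ * cpow (suc r) m + β * cpow (suc (suc r)) m

  module _ (C : Series) (isC : IsCab a b C) where

    xC²⊛ : ∀ X → xS (C ⊛ C) ⊛ X ≈ xS (C ⊛ (C ⊛ X))
    xC²⊛ X zero    = ⊛-xSˡ (C ⊛ C) X zero
    xC²⊛ X (suc n) = trans (⊛-xSˡ (C ⊛ C) X (suc n)) (⊛-assoc C C X n)

    C⊛-unfold : ∀ X → C ⊛ X ≈ X ⊕ (scale δ (xS (C ⊛ X)) ⊕ scale β (xS (C ⊛ (C ⊛ X))))
    C⊛-unfold X n = begin
      (C ⊛ X) n                                  ≡⟨ ⊛-congˡ X isC n ⟩
      ((oneS ⊕ (P ⊕ Q)) ⊛ X) n                   ≡⟨ ⊛-distribʳ-⊕ oneS (P ⊕ Q) X n ⟩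
      (oneS ⊛ X) n + ((P ⊕ Q) ⊛ X) n             ≡⟨ cong₂ _+_ (⊛-identityˡ X n) (⊛-distribʳ-⊕ P Q X n) ⟩
      X n + ((P ⊛ X) n + (Q ⊛ X) n)              ≡⟨ cong (_+_ (X n)) (cong₂ _+_ P⊛X Q⊛X) ⟩
      X n + (δ * xS (C ⊛ X) n + β * xS (C ⊛ (C ⊛ X)) n) ∎
      where
      P Q : Series
      P = scale δ (xS C)
      Q = scale β (xS (C ⊛ C))
      P⊛X : (P ⊛ X) n ≡ δ * xS (C ⊛ X) n
      P⊛X = trans (⊛-scaleˡ δ (xS C) X n) (cong (δ *_) (⊛-xSˡ C X n))
      Q⊛X : (Q ⊛ X) n ≡ β * xS (C ⊛ (C ⊛ X)) n
      Q⊛X = trans (⊛-scaleˡ β (xS (C ⊛ C)) X n) (cong (β *_) (xC²⊛ X n))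

    powS-C≡cpow : ∀ r N → powS C r N ≡ cpow r (double N)
    powS-C≡cpow zero    zero    = refl
    powS-C≡cpow zero    (suc N) = refl
    powS-C≡cpow (suc r) zero    = begin
      (C ⊛ powS C r) 0                           ≡⟨ C⊛-unfold (powS C r) 0 ⟩
      powS C r 0 + (δ * + 0 + β * + 0)           ≡⟨ cong (_+ (δ * + 0 + β * + 0)) (powS-C≡cpow r 0) ⟩
      + 1 + (δ * + 0 + β * + 0)                  ≡⟨ drop-zeros δ β ⟩
      + 1                                        ∎
      where
      drop-zeros : ∀ x y → + 1 + (x * + 0 + y * + 0) ≡ + 1
      drop-zeros = solve-∀
    powS-C≡cpow (suc r) (suc N) = begin
      (C ⊛ powS C r) (suc N)
        ≡⟨ C⊛-unfold (powS C r) (suc N) ⟩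
      powS C r (suc N) + (δ * powS C (suc r) N + β * powS C (suc (suc r)) N)
        ≡⟨ cong₂ _+_ (powS-C≡cpow r (suc N))
                     (cong₂ _+_ (cong (δ *_) (powS-C≡cpow (suc r) N)) (cong (β *_) (powS-C≡cpow (suc (suc r)) N))) ⟩
      cpow r (double (suc N)) + (δ * cpow (suc r) (double N) + β * cpow (suc (suc r)) (double N))
        ≡⟨ ℤ.+-assoc (cpow r (double (suc N))) _ _ ⟨
      cpow (suc r) (double (suc N))
        ∎

    bxC² : Series
    bxC² = scale β (xS (C ⊛ C))

    C²^ : ℕ → Series
    C²^ l = powS C (double l)

    powS-bxC² : ∀ l → powS bxC² l ≈ scale (β ^ l) (xS^ l (C²^ l))
    powS-bxC² zero    n = sym (ℤ.*-identityˡ _)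
    powS-bxC² (suc l) n = begin
      (bxC² ⊛ powS bxC² l) n                                ≡⟨ ⊛-congʳ bxC² (powS-bxC² l) n ⟩
      (bxC² ⊛ scale (β ^ l) (xS^ l (C²^ l))) n             ≡⟨ ⊛-scaleʳ (β ^ l) bxC² (xS^ l (C²^ l)) n ⟩
      β ^ l * (bxC² ⊛ xS^ l (C²^ l)) n                     ≡⟨ cong (β ^ l *_) (⊛-xS^ʳ l bxC² (C²^ l) n) ⟩
      β ^ l * xS^ l (bxC² ⊛ C²^ l) n                       ≡⟨ cong (β ^ l *_) (xS^-cong l bxC²⊛ n) ⟩
      β ^ l * xS^ l (scale β (xS (C²^ (suc l)))) n         ≡⟨ cong (β ^ l *_) (xS^-scale l β (xS (C²^ (suc l))) n) ⟩
      β ^ l * (β * xS^ l (xS (C²^ (suc l))) n)             ≡⟨ reassoc (β ^ l) β _ ⟩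
      β ^ suc l * xS^ (suc l) (C²^ (suc l)) n              ∎
      where
      reassoc : ∀ x y z → x * (y * z) ≡ (y * x) * z
      reassoc = solve-∀
      bxC²⊛ : bxC² ⊛ C²^ l ≈ scale β (xS (C²^ (suc l)))
      bxC²⊛ m = trans (⊛-scaleˡ β (xS (C ⊛ C)) (C²^ l) m) (cong (β *_) (xC²⊛ (C²^ l) m))

    riordanEntry≡cpow : ∀ n l → l ≤ n →
      riordanEntry (scale (+ a) (C ⊛ C)) bxC² n l ≡ + a * (β ^ l * cpow (suc (suc (double l))) (double (n ∸ l)))
    riordanEntry≡cpow n l l≤n = begin
      (scale (+ a) (C ⊛ C) ⊛ powS bxC² l) n
        ≡⟨ cong (scale (+ a) (C ⊛ C) ⊛ powS bxC² l) (ℕ.m+[n∸m]≡n l≤n) ⟨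
      (scale (+ a) (C ⊛ C) ⊛ powS bxC² l) (l ℕ.+ t)
        ≡⟨ ⊛-congʳ (scale (+ a) (C ⊛ C)) (powS-bxC² l) (l ℕ.+ t) ⟩
      (scale (+ a) (C ⊛ C) ⊛ scale (β ^ l) (xS^ l (C²^ l))) (l ℕ.+ t)
        ≡⟨ ⊛-scaleˡ (+ a) (C ⊛ C) (scale (β ^ l) (xS^ l (C²^ l))) (l ℕ.+ t) ⟩
      + a * ((C ⊛ C) ⊛ scale (β ^ l) (xS^ l (C²^ l))) (l ℕ.+ t)
        ≡⟨ cong (+ a *_) (⊛-scaleʳ (β ^ l) (C ⊛ C) (xS^ l (C²^ l)) (l ℕ.+ t)) ⟩
      + a * (β ^ l * ((C ⊛ C) ⊛ xS^ l (C²^ l)) (l ℕ.+ t))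
        ≡⟨ cong (λ z → + a * (β ^ l * z)) (trans (⊛-xS^ʳ l (C ⊛ C) (C²^ l) (l ℕ.+ t)) (xS^-+ l t ((C ⊛ C) ⊛ C²^ l))) ⟩
      + a * (β ^ l * ((C ⊛ C) ⊛ C²^ l) t)
        ≡⟨ cong (λ z → + a * (β ^ l * z)) (trans (⊛-assoc C C (C²^ l) t) (powS-C≡cpow (double (suc l)) t)) ⟩
      + a * (β ^ l * cpow (suc (suc (double l))) (double t))
        ∎
      where
      t : ℕ
      t = n ∸ l

module PathCounts (a b k : ℕ) where
  open import Data.Bool using (Bool; true; false; _∧_; if_then_else_; T?)
  open import Data.List using (List; []; _∷_; map; upTo; applyUpTo; concatMap; filter; _++_)
  open import Data.List.Properties using (map-cong; map-∘; map-++; map-upTo)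
  open import Data.Nat using (_+_; _*_; _⊔_; _≡ᵇ_; _<ᵇ_)
  open import Data.Nat.ListAction using (sum)
  open import Data.Nat.ListAction.Properties using (sum-++)
  open import Data.Nat.Tactic.RingSolver using (solve-∀)

  when : Bool → ℕ → ℕ
  when c n = if c then n else 0

  when-∧ : ∀ c d n → when (c ∧ d) n ≡ when c (when d n)
  when-∧ true  d n = refl
  when-∧ false d n = refl

  when-+ : ∀ c m n → when c (m + n) ≡ when c m + when c n
  when-+ true  m n = refl
  when-+ false m n = refl

  when-comm : ∀ c d n → when c (when d n) ≡ when d (when c n)
  when-comm true  d     n = refl
  when-comm false true  n = refl
  when-comm false false n = refl

  module _ {A : Set} where

    sum-map-cong : ∀ {f g : A → ℕ} xs → (∀ x → f x ≡ g x) → sum (map f xs) ≡ sum (map g xs)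
    sum-map-cong xs f≗g = cong sum (map-cong f≗g xs)

    sum-map-+ : ∀ (f g : A → ℕ) xs → sum (map (λ x → f x + g x) xs) ≡ sum (map f xs) + sum (map g xs)
    sum-map-+ f g []       = refl
    sum-map-+ f g (x ∷ xs) = trans (cong (f x + g x +_) (sum-map-+ f g xs)) (interchange (f x) (g x) _ _)
      where
      interchange : ∀ w x y z → w + x + (y + z) ≡ w + y + (x + z)
      interchange = solve-∀

    sum-map-* : ∀ c (f : A → ℕ) xs → sum (map (λ x → c * f x) xs) ≡ c * sum (map f xs)
    sum-map-* c f []       = sym (ℕ.*-zeroʳ c)
    sum-map-* c f (x ∷ xs) = trans (cong (c * f x +_) (sum-map-* c f xs)) (sym (ℕ.*-distribˡ-+ c (f x) _))

    sum-map-when : ∀ c (f : A → ℕ) xs → sum (map (λ x → when c (f x)) xs) ≡ when c (sum (map f xs))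
    sum-map-when true  f xs       = refl
    sum-map-when false f []       = refl
    sum-map-when false f (x ∷ xs) = sum-map-when false f xs

    sum-map-concatMap : ∀ {B : Set} (f : A → ℕ) (g : B → List A) xs →
      sum (map f (concatMap g xs)) ≡ sum (map (λ y → sum (map f (g y))) xs)
    sum-map-concatMap f g []       = refl
    sum-map-concatMap f g (y ∷ ys) = begin
      sum (map f (g y ++ concatMap g ys))               ≡⟨ cong sum (map-++ f (g y) (concatMap g ys)) ⟩
      sum (map f (g y) ++ map f (concatMap g ys))       ≡⟨ sum-++ (map f (g y)) _ ⟩
      sum (map f (g y)) + sum (map f (concatMap g ys))  ≡⟨ cong (sum (map f (g y)) +_) (sum-map-concatMap f g ys) ⟩
      sum (map f (g y)) + sum (map (λ y → sum (map f (g y))) ys) ∎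

    sum-map-filter : ∀ (P : A → Bool) (f : A → ℕ) xs →
      sum (map f (filter (λ x → T? (P x)) xs)) ≡ sum (map (λ x → when (P x) (f x)) xs)
    sum-map-filter P f []       = refl
    sum-map-filter P f (x ∷ xs) with P x
    ... | true  = cong (f x +_) (sum-map-filter P f xs)
    ... | false = sum-map-filter P f xs

  sum-colors : ∀ q M n → q ≤ M → sum (map (λ c → when (c <ᵇ q) n) (upTo M)) ≡ q * n
  sum-colors q M n q≤M = trans (cong sum (map-upTo (λ c → when (c <ᵇ q) n) M)) (count q M q≤M)
    where
    count : ∀ q M → q ≤ M → sum (applyUpTo (λ c → when (c <ᵇ q) n) M) ≡ q * n
    count zero    zero    _         = refl
    count zero    (suc M) _         = count zero M z≤n
    count (suc q) (suc M) (s≤s q≤M) = cong (n +_) (count q M q≤M)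

  ∑words : ℕ → (List Step → ℕ) → ℕ
  ∑words m F = sum (map F (words a b m))

  ∑words-suc : ∀ m F →
    ∑words (suc m) F ≡ ∑words m (λ w → F (U ∷ w) + sum (map (λ c → F (D c ∷ w)) (upTo (a ⊔ b))))
  ∑words-suc m F = trans (sum-map-concatMap F _ (words a b m)) (sum-map-cong (words a b m) extend)
    where
    extend : ∀ w → sum (map F (map (_∷ w) (alphabet a b))) ≡ F (U ∷ w) + sum (map (λ c → F (D c ∷ w)) (upTo (a ⊔ b)))
    extend w = cong (F (U ∷ w) +_) (cong sum (trans (sym (map-∘ (map D (upTo (a ⊔ b))))) (sym (map-∘ (upTo (a ⊔ b))))))

  colorBound : Bool → ℕ
  colorBound true  = a
  colorBound false = b

  colorBound≤ : ∀ afterU → colorBound afterU ≤ a ⊔ b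
  colorBound≤ true  = ℕ.m≤m⊔n a b
  colorBound≤ false = ℕ.m≤n⊔m a b

  ∑valid : ℕ → Bool → ℕ → (List Step → ℕ) → ℕ
  ∑valid h afterU m F = ∑words m (λ w → when (validFrom a b h afterU w) (F w))

  ∑valid-from-0 : ∀ afterU m F → ∑valid 0 afterU (suc m) F ≡ ∑valid 1 true m (F ∘ (U ∷_))
  ∑valid-from-0 afterU m F = trans (∑words-suc m _) (sum-map-cong (words a b m) no-down-step)
    where
    no-down-step : ∀ w → when (validFrom a b 1 true w) (F (U ∷ w)) + sum (map (λ c → when false (F (D c ∷ w))) (upTo (a ⊔ b)))
                         ≡ when (validFrom a b 1 true w) (F (U ∷ w))
    no-down-step w = trans (cong (when (validFrom a b 1 true w) (F (U ∷ w)) +_) (sum-map-when false (λ c → F (D c ∷ w)) (upTo (a ⊔ b)))) (ℕ.+-identityʳ _)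

  ∑valid-suc : ∀ h afterU m F Fᵈ → (∀ c w → F (D c ∷ w) ≡ Fᵈ w) →
    ∑valid (suc h) afterU (suc m) F ≡ ∑valid (suc (suc h)) true m (F ∘ (U ∷_)) + colorBound afterU * ∑valid h false m Fᵈ
  ∑valid-suc h afterU m F Fᵈ F-down = begin
    ∑valid (suc h) afterU (suc m) F
      ≡⟨ ∑words-suc m _ ⟩
    ∑words m (λ w → up w + sum (map (λ c → when (validFrom a b (suc h) afterU (D c ∷ w)) (F (D c ∷ w))) (upTo (a ⊔ b))))
      ≡⟨ sum-map-cong (words a b m) (λ w → cong (up w +_) (down w)) ⟩
    ∑words m (λ w → up w + colorBound afterU * when (validFrom a b h false w) (Fᵈ w))
      ≡⟨ sum-map-+ up _ (words a b m) ⟩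
    ∑valid (suc (suc h)) true m (F ∘ (U ∷_)) + ∑words m (λ w → colorBound afterU * when (validFrom a b h false w) (Fᵈ w))
      ≡⟨ cong (∑valid (suc (suc h)) true m (F ∘ (U ∷_)) +_) (sum-map-* (colorBound afterU) _ (words a b m)) ⟩
    ∑valid (suc (suc h)) true m (F ∘ (U ∷_)) + colorBound afterU * ∑valid h false m Fᵈ
      ∎
    where
    up : List Step → ℕ
    up w = when (validFrom a b (suc (suc h)) true w) (F (U ∷ w))
    valid-down : ∀ afterU c w n →
      when (validFrom a b (suc h) afterU (D c ∷ w)) n ≡ when (c <ᵇ colorBound afterU) (when (validFrom a b h false w) n)
    valid-down true  c w n = when-∧ (c <ᵇ a) _ n
    valid-down false c w n = when-∧ (c <ᵇ b) _ n
    down : ∀ w → sum (map (λ c → when (validFrom a b (suc h) afterU (D c ∷ w)) (F (D c ∷ w))) (upTo (a ⊔ b)))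
               ≡ colorBound afterU * when (validFrom a b h false w) (Fᵈ w)
    down w = trans (sum-map-cong (upTo (a ⊔ b)) (λ c → trans (valid-down afterU c w _)
                     (cong (when (c <ᵇ colorBound afterU) ∘ when (validFrom a b h false w)) (F-down c w))))
                   (sum-colors (colorBound afterU) (a ⊔ b) _ (colorBound≤ afterU))

  #paths : ℕ → Bool → ℕ → ℕ
  #paths h afterU m = ∑valid h afterU m (λ _ → 1)

  -- peaksAtFrom counts a peak at its u-step; peaks counts it at its d-step, where the flag of
  -- validFrom tells whether the previous step was u.
  peaks : ℕ → Bool → List Step → ℕ
  peaks h afterU []        = 0
  peaks h afterU (U ∷ s)   = peaks (suc h) true s
  peaks h afterU (D _ ∷ s) = when (afterU ∧ (h ≡ᵇ k)) 1 + peaks (h ∸ 1) false s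

  #peaks : ℕ → Bool → ℕ → ℕ
  #peaks h afterU m = ∑valid h afterU m (peaks h afterU)

  peaksAtFrom≡peaks : ∀ h s → peaksAtFrom k h s ≡ peaks h false s
  peaksAtFrom≡peaks h []        = refl
  peaksAtFrom≡peaks h (U ∷ s)   = trans (cong (when (startsWithD s ∧ (suc h ≡ᵇ k)) 1 +_) (peaksAtFrom≡peaks (suc h) s))
                                        (sym (peaks-afterU (suc h) s))
    where
    peaks-afterU : ∀ h s → peaks h true s ≡ when (startsWithD s ∧ (h ≡ᵇ k)) 1 + peaks h false s
    peaks-afterU h []        = refl
    peaks-afterU h (U ∷ s)   = refl
    peaks-afterU h (D _ ∷ s) = refl
  peaksAtFrom≡peaks h (D _ ∷ s) = peaksAtFrom≡peaks (h ∸ 1) s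

  total-peaks≡#peaks : ∀ m → sum (map (peaksAt k) (coloredDyckPaths a b m)) ≡ #peaks 0 false m
  total-peaks≡#peaks m = trans (sum-map-filter (isColoredDyck a b) (peaksAt k) (words a b m))
                               (sum-map-cong (words a b m) (λ w → cong (when (isColoredDyck a b w)) (peaksAtFrom≡peaks 0 w)))

  #peaks-[] : ∀ h afterU → #peaks h afterU 0 ≡ 0
  #peaks-[] zero    afterU = refl
  #peaks-[] (suc h) afterU = refl

  #paths-from-0 : ∀ afterU m → #paths 0 afterU (suc m) ≡ #paths 1 true m
  #paths-from-0 afterU m = ∑valid-from-0 afterU m (λ _ → 1)

  #peaks-from-0 : ∀ afterU m → #peaks 0 afterU (suc m) ≡ #peaks 1 true m
  #peaks-from-0 afterU m = ∑valid-from-0 afterU m (peaks 0 afterU)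

  #paths-suc : ∀ h afterU m →
    #paths (suc h) afterU (suc m) ≡ #paths (suc (suc h)) true m + colorBound afterU * #paths h false m
  #paths-suc h afterU m = ∑valid-suc h afterU m (λ _ → 1) (λ _ → 1) (λ _ _ → refl)

  #peaks-suc : ∀ h afterU m →
    #peaks (suc h) afterU (suc m) ≡
    #peaks (suc (suc h)) true m + colorBound afterU * (when (afterU ∧ (suc h ≡ᵇ k)) (#paths h false m) + #peaks h false m)
  #peaks-suc h afterU m = trans (∑valid-suc h afterU m _ Fᵈ (λ _ _ → refl))
                                (cong (λ z → #peaks (suc (suc h)) true m + colorBound afterU * z) split)
    where
    peak? : Bool
    peak? = afterU ∧ (suc h ≡ᵇ k)
    Fᵈ : List Step → ℕ
    Fᵈ w = when peak? 1 + peaks h false w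
    split : ∑valid h false m Fᵈ ≡ when peak? (#paths h false m) + #peaks h false m
    split = begin
      ∑valid h false m Fᵈ
        ≡⟨ sum-map-cong (words a b m) (λ w → trans (when-+ (validFrom a b h false w) _ _)
                                                   (cong (_+ _) (when-comm (validFrom a b h false w) peak? 1))) ⟩
      ∑words m (λ w → when peak? (when (validFrom a b h false w) 1) + when (validFrom a b h false w) (peaks h false w))
        ≡⟨ sum-map-+ _ _ (words a b m) ⟩
      ∑words m (λ w → when peak? (when (validFrom a b h false w) 1)) + #peaks h false m
        ≡⟨ cong (_+ #peaks h false m) (sum-map-when peak? _ (words a b m)) ⟩
      when peak? (#paths h false m) + #peaks h false m
        ∎

module PeakClosedForm (a b ℓ : ℕ) where
  open import Data.Bool using (Bool; true; false; if_then_else_)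
  open import Data.Empty using (⊥-elim)
  open import Data.Integer using (ℤ; +_; _+_; _*_; _-_; _^_)
  import Data.Integer.Properties as ℤ
  open import Data.Integer.Tactic.RingSolver using (solve-∀)
  open import Data.Nat using (_≡ᵇ_; _<ᵇ_; _≤ᵇ_)
  import Data.Nat.Tactic.RingSolver as ℕ-Solver
  open import Relation.Binary.Definitions using (Tri; tri<; tri≈; tri>)
  open Coefficients a b
  open PathCounts a b (suc ℓ)

  shiftedCpow : ℕ → ℕ → ℕ → ℤ
  shiftedCpow r zero    m       = cpow r m
  shiftedCpow r (suc d) zero    = + 0
  shiftedCpow r (suc d) (suc m) = shiftedCpow r d m

  shiftedCpow-+ : ∀ r d t → shiftedCpow r d (d ℕ.+ t) ≡ cpow r t
  shiftedCpow-+ r zero    t = refl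
  shiftedCpow-+ r (suc d) t = shiftedCpow-+ r d t

  private
    drop-zeros : ∀ x y z → x + y * + 0 + z * + 0 ≡ x
    drop-zeros = solve-∀

  shiftedCpow-suc : ∀ r d m →
    shiftedCpow (suc r) d m ≡ shiftedCpow r d m + δ * shiftedCpow (suc r) (suc (suc d)) m + β * shiftedCpow (suc (suc r)) (suc (suc d)) m
  shiftedCpow-suc r zero    zero          = sym (drop-zeros (cpow r 0) δ β)
  shiftedCpow-suc r zero    (suc zero)    = sym (drop-zeros (cpow r 1) δ β)
  shiftedCpow-suc r zero    (suc (suc m)) = refl
  shiftedCpow-suc r (suc d) zero          = sym (drop-zeros (+ 0) δ β)
  shiftedCpow-suc r (suc d) (suc m)       = shiftedCpow-suc r d m

  pos-+-* : ∀ x y z → + (x ℕ.+ y ℕ.* z) ≡ + x + + y * + z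
  pos-+-* x y z = trans (ℤ.pos-+ x (y ℕ.* z)) (cong (_+_ (+ x)) (ℤ.pos-* y z))

  #paths-afterU : ∀ h m → + #paths (suc h) true (suc m) ≡ + #paths (suc h) false (suc m) + δ * + #paths h false m
  #paths-afterU h m = begin
    + #paths (suc h) true (suc m)                          ≡⟨ cong +_ (#paths-suc h true m) ⟩
    + (#paths (suc (suc h)) true m ℕ.+ a ℕ.* #paths h false m)
                                                           ≡⟨ pos-+-* (#paths (suc (suc h)) true m) a (#paths h false m) ⟩
    + #paths (suc (suc h)) true m + + a * + #paths h false m
                                                           ≡⟨ a≡b+δ (+ #paths (suc (suc h)) true m) (+ a) β (+ #paths h false m) ⟩
    + #paths (suc (suc h)) true m + β * + #paths h false m + δ * + #paths h false m
                                                           ≡⟨ cong (_+ δ * + #paths h false m) (pos-+-* (#paths (suc (suc h)) true m) b (#paths h false m)) ⟨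
    + (#paths (suc (suc h)) true m ℕ.+ b ℕ.* #paths h false m) + δ * + #paths h false m
                                                           ≡⟨ cong (λ z → + z + δ * + #paths h false m) (#paths-suc h false m) ⟨
    + #paths (suc h) false (suc m) + δ * + #paths h false m ∎
    where
    a≡b+δ : ∀ x a b y → x + a * y ≡ x + b * y + (a - b) * y
    a≡b+δ = solve-∀

  mutual
    #paths≡ : ∀ m h → + #paths h false m ≡ β ^ h * shiftedCpow (suc h) h m
    #paths≡ zero    zero    = refl
    #paths≡ zero    (suc h) = sym (ℤ.*-zeroʳ (β ^ suc h))
    #paths≡ (suc m) zero    = begin
      + #paths 0 false (suc m)                      ≡⟨ cong +_ (#paths-from-0 false m) ⟩
      + #paths 1 true m                             ≡⟨ #paths-afterU≡ m 0 ⟩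
      β ^ 1 * shiftedCpow 2 1 m + δ * (β ^ 0 * shiftedCpow 1 1 m)
                                                    ≡⟨ regroup β δ (shiftedCpow 2 1 m) (shiftedCpow 1 1 m) (cpow 0 (suc m)) (cpow-0-suc m) ⟩
      β ^ 0 * (shiftedCpow 0 0 (suc m) + δ * shiftedCpow 1 2 (suc m) + β * shiftedCpow 2 2 (suc m))
                                                    ≡⟨ cong (β ^ 0 *_) (shiftedCpow-suc 0 0 (suc m)) ⟨
      β ^ 0 * shiftedCpow 1 0 (suc m)               ∎
      where
      cpow-0-suc : ∀ m → cpow 0 (suc m) ≡ + 0
      cpow-0-suc zero    = refl
      cpow-0-suc (suc m) = refl
      regroup : ∀ b s x y z → z ≡ + 0 → b * + 1 * x + s * (+ 1 * y) ≡ + 1 * (z + s * y + b * x)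
      regroup b s x y _ refl = polynomial b s x y
        where
        polynomial : ∀ b s x y → b * + 1 * x + s * (+ 1 * y) ≡ + 1 * (+ 0 + s * y + b * x)
        polynomial = solve-∀
    #paths≡ (suc m) (suc h) = begin
      + #paths (suc h) false (suc m)
        ≡⟨ trans (cong +_ (#paths-suc h false m)) (pos-+-* (#paths (suc (suc h)) true m) b (#paths h false m)) ⟩
      + #paths (suc (suc h)) true m + β * + #paths h false m
        ≡⟨ cong₂ (λ u v → u + β * v) (#paths-afterU≡ m (suc h)) (#paths≡ m h) ⟩
      β ^ suc (suc h) * shiftedCpow (3 ℕ.+ h) (2 ℕ.+ h) m + δ * (β ^ suc h * shiftedCpow (2 ℕ.+ h) (2 ℕ.+ h) m)
        + β * (β ^ h * shiftedCpow (suc h) h m)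
        ≡⟨ regroup β δ (β ^ h) (shiftedCpow (3 ℕ.+ h) (2 ℕ.+ h) m) (shiftedCpow (2 ℕ.+ h) (2 ℕ.+ h) m) (shiftedCpow (suc h) h m) ⟩
      β ^ suc h * (shiftedCpow (suc h) (suc h) (suc m) + δ * shiftedCpow (2 ℕ.+ h) (3 ℕ.+ h) (suc m)
                   + β * shiftedCpow (3 ℕ.+ h) (3 ℕ.+ h) (suc m))
        ≡⟨ cong (β ^ suc h *_) (shiftedCpow-suc (suc h) (suc h) (suc m)) ⟨
      β ^ suc h * shiftedCpow (2 ℕ.+ h) (suc h) (suc m)
        ∎
      where
      regroup : ∀ b s u x y z → b * (b * u) * x + s * (b * u * y) + b * (u * z) ≡ b * u * (z + s * y + b * x)
      regroup = solve-∀

    #paths-afterU≡ : ∀ m h →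
      + #paths (suc h) true m ≡ β ^ suc h * shiftedCpow (2 ℕ.+ h) (suc h) m + δ * (β ^ h * shiftedCpow (suc h) (suc h) m)
    #paths-afterU≡ zero    h = sym (zeros (β ^ suc h) δ (β ^ h))
      where
      zeros : ∀ x y z → x * + 0 + y * (z * + 0) ≡ + 0
      zeros = solve-∀
    #paths-afterU≡ (suc m) h = begin
      + #paths (suc h) true (suc m)                            ≡⟨ #paths-afterU h m ⟩
      + #paths (suc h) false (suc m) + δ * + #paths h false m  ≡⟨ cong₂ (λ u v → u + δ * v) (#paths≡ (suc m) (suc h)) (#paths≡ m h) ⟩
      β ^ suc h * shiftedCpow (2 ℕ.+ h) (suc h) (suc m) + δ * (β ^ h * shiftedCpow (suc h) (suc h) (suc m)) ∎

  private
    <ᵇ-true : ∀ {m n} → m < n → (m <ᵇ n) ≡ true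
    <ᵇ-true {zero}  {suc n} _       = refl
    <ᵇ-true {suc m} {suc n} (s≤s p) = <ᵇ-true p

    <ᵇ-false : ∀ {m n} → n ≤ m → (m <ᵇ n) ≡ false
    <ᵇ-false {m}     {zero}  _       = refl
    <ᵇ-false {suc m} {suc n} (s≤s p) = <ᵇ-false p

    ≤ᵇ-true : ∀ {i h} → i ≤ h → (i ≤ᵇ h) ≡ true
    ≤ᵇ-true {zero}  _ = refl
    ≤ᵇ-true {suc i} p = <ᵇ-true p

    ≤ᵇ-false : ∀ {i h} → h < i → (i ≤ᵇ h) ≡ false
    ≤ᵇ-false {suc i} (s≤s p) = <ᵇ-false p

    ≡ᵇ-refl : ∀ h → (h ≡ᵇ h) ≡ true
    ≡ᵇ-refl zero    = refl
    ≡ᵇ-refl (suc h) = ≡ᵇ-refl h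

    ≡ᵇ-false : ∀ {i h} → i ≢ h → (i ≡ᵇ h) ≡ false
    ≡ᵇ-false {zero}  {zero}  i≢h = ⊥-elim (i≢h refl)
    ≡ᵇ-false {zero}  {suc h} _   = refl
    ≡ᵇ-false {suc i} {zero}  _   = refl
    ≡ᵇ-false {suc i} {suc h} i≢h = ≡ᵇ-false (i≢h ∘ cong suc)

  whenℤ : Bool → ℤ → ℤ
  whenℤ c x = if c then x else + 0

  pos-when : ∀ c n → + when c n ≡ whenℤ c (+ n)
  pos-when true  n = refl
  pos-when false n = refl

  whenℤ-*-zero : ∀ c u → whenℤ c (u * + 0) ≡ + 0
  whenℤ-*-zero true  u = ℤ.*-zeroʳ u
  whenℤ-*-zero false u = refl

  k : ℕ
  k = suc ℓ

  peakPower : ℕ → ℕ → ℕ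
  peakPower h j = suc (suc (h ℕ.+ (j ℕ.+ j)))

  peakTerm : ℕ → ℕ → ℕ → ℤ
  peakTerm h j m = β ^ (h ℕ.+ j) * shiftedCpow (peakPower h j) (peakPower h j) m

  -- Summand i comes from splitting a path from height h at the counted peak, i being the lowest
  -- level reached before it; the proof only checks the recurrences, not this reading.
  peakTerms : ℕ → ℕ → ℤ
  peakTerms h m = ∑ k (λ i → whenℤ (i ≤ᵇ h) (peakTerm h (ℓ ∸ i) m))

  peakSum : ℕ → ℕ → ℤ
  peakSum h m = + a * peakTerms h m

  δ-term β-term new-peaks : ℕ → ℕ → ℤ
  δ-term h       zero    = + 0
  δ-term h       (suc m) = δ * peakSum h m
  β-term zero    m       = + 0
  β-term (suc h) m       = β * peakSum h m
  new-peaks h    zero    = + 0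
  new-peaks h    (suc m) = + a * whenℤ (suc h ≡ᵇ k) (β ^ h * shiftedCpow (suc h) h m)

  private
    term term↑ termδ termβ termBoundary : ℕ → ℕ → ℕ → ℕ → ℤ
    term h m i j         = whenℤ (i ≤ᵇ h) (peakTerm h j (suc m))
    term↑ h m i j        = whenℤ (i ≤ᵇ suc h) (peakTerm (suc h) j m)
    termδ h m i j        = δ * whenℤ (i ≤ᵇ h) (β ^ (h ℕ.+ j) * shiftedCpow (peakPower h j) (suc (suc (peakPower h j))) (suc m))
    termβ zero    m i j  = + 0
    termβ (suc h) m i j  = β * whenℤ (i ≤ᵇ h) (peakTerm h j m)
    termBoundary h m i j = whenℤ (i ≡ᵇ h) (β ^ (h ℕ.+ j) * shiftedCpow (suc (h ℕ.+ (j ℕ.+ j))) (suc (h ℕ.+ (j ℕ.+ j))) m)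
                         - whenℤ (i ≡ᵇ suc h) (peakTerm (suc h) j m)

    termβ-vanishes : ∀ h m i j → h ≤ i → termβ h m i j ≡ + 0
    termβ-vanishes zero    m i j _   = refl
    termβ-vanishes (suc h) m i j h<i rewrite ≤ᵇ-false h<i = ℤ.*-zeroʳ β

    term-split-below : ∀ h m i j → i < h →
      term h m i j ≡ term↑ h m i j + termδ h m i j + termβ h m i j + termBoundary h m i j
    term-split-below (suc h) m i j i<1+h
      rewrite ≤ᵇ-true (ℕ.<⇒≤ i<1+h) | ≤ᵇ-true (ℕ.m≤n⇒m≤1+n (ℕ.<⇒≤ i<1+h)) | ≤ᵇ-true (ℕ.≤-pred i<1+h)
            | ≡ᵇ-false (ℕ.<⇒≢ i<1+h) | ≡ᵇ-false (ℕ.<⇒≢ (ℕ.m<n⇒m<1+n i<1+h))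
      = trans (cong (β ^ (suc h ℕ.+ j) *_) (shiftedCpow-suc (suc (suc h ℕ.+ (j ℕ.+ j))) (peakPower (suc h) j) (suc m)))
              (expand β δ (β ^ (h ℕ.+ j)) _ _ _)
      where
      expand : ∀ b s u p q t → b * u * (p + s * q + b * t) ≡ b * (b * u) * t + s * (b * u * q) + b * (u * p) + (+ 0 - + 0)
      expand = solve-∀

    term-split-at : ∀ h m j → term h m h j ≡ term↑ h m h j + termδ h m h j + termβ h m h j + termBoundary h m h j
    term-split-at h m j
      rewrite ≤ᵇ-true (ℕ.≤-refl {h}) | ≤ᵇ-true (ℕ.n≤1+n h) | ≡ᵇ-refl h | ≡ᵇ-false (ℕ.<⇒≢ (ℕ.n<1+n h))
      = trans (cong (β ^ (h ℕ.+ j) *_) (shiftedCpow-suc (suc (h ℕ.+ (j ℕ.+ j))) (peakPower h j) (suc m)))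
              (expand β δ (β ^ (h ℕ.+ j)) _ _ _ (termβ h m h j) (termβ-vanishes h m h j ℕ.≤-refl))
      where
      expand : ∀ b s u p q t z → z ≡ + 0 → u * (p + s * q + b * t) ≡ b * u * t + s * (u * q) + z + (u * p - + 0)
      expand b s u p q t _ refl = polynomial b s u p q t
        where
        polynomial : ∀ b s u p q t → u * (p + s * q + b * t) ≡ b * u * t + s * (u * q) + + 0 + (u * p - + 0)
        polynomial = solve-∀

    term-split-next : ∀ h m j →
      term h m (suc h) j ≡ term↑ h m (suc h) j + termδ h m (suc h) j + termβ h m (suc h) j + termBoundary h m (suc h) j
    term-split-next h m j
      rewrite ≤ᵇ-false (ℕ.n<1+n h) | ≤ᵇ-true (ℕ.≤-refl {suc h}) | ≡ᵇ-refl (suc h) | ≡ᵇ-false (ℕ.>⇒≢ (ℕ.n<1+n h))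
      = trans (sym (cancel δ (peakTerm (suc h) j m)))
              (cong (λ z → peakTerm (suc h) j m + δ * + 0 + z + (+ 0 - peakTerm (suc h) j m))
                    (sym (termβ-vanishes h m (suc h) j (ℕ.n≤1+n h))))
      where
      cancel : ∀ s x → x + s * + 0 + + 0 + (+ 0 - x) ≡ + 0
      cancel = solve-∀

    term-split-beyond : ∀ h m i j → suc h < i →
      term h m i j ≡ term↑ h m i j + termδ h m i j + termβ h m i j + termBoundary h m i j
    term-split-beyond h m i j 1+h<i
      rewrite ≤ᵇ-false (ℕ.<-trans (ℕ.n<1+n h) 1+h<i) | ≤ᵇ-false 1+h<i
            | ≡ᵇ-false (ℕ.>⇒≢ (ℕ.<-trans (ℕ.n<1+n h) 1+h<i)) | ≡ᵇ-false (ℕ.>⇒≢ 1+h<i)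
      = trans (sym (zeros δ)) (cong (λ z → + 0 + δ * + 0 + z + (+ 0 - + 0))
                                    (sym (termβ-vanishes h m i j (ℕ.<⇒≤ (ℕ.<-trans (ℕ.n<1+n h) 1+h<i)))))
      where
      zeros : ∀ s → + 0 + s * + 0 + + 0 + (+ 0 - + 0) ≡ + 0
      zeros = solve-∀

    term-split : ∀ h m i j → term h m i j ≡ term↑ h m i j + termδ h m i j + termβ h m i j + termBoundary h m i j
    term-split h m i j with ℕ.<-cmp i h | ℕ.<-cmp i (suc h)
    ... | tri< i<h _ _   | _                = term-split-below h m i j i<h
    ... | tri≈ _ refl _  | _                = term-split-at i m j
    ... | tri> _ _ h<i   | tri< i<1+h _ _   = ⊥-elim (ℕ.<⇒≱ i<1+h h<i)
    ... | tri> _ _ _     | tri≈ _ refl _    = term-split-next h m j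
    ... | tri> _ _ _     | tri> _ _ 1+h<i   = term-split-beyond h m i j 1+h<i

    boundary-sum : ∀ h m → + a * ∑ k (λ i → termBoundary h m i (ℓ ∸ i)) ≡ new-peaks h m
    boundary-sum h m =
      trans (cong (+ a *_) (trans (∑-distrib-- k (λ i → whenℤ (i ≡ᵇ h) (lower i)) (λ i → whenℤ (i ≡ᵇ suc h) (peakTerm (suc h) (ℓ ∸ i) m)))
                                  (cong₂ _-_ (∑-select k h lower) (∑-select k (suc h) (λ i → peakTerm (suc h) (ℓ ∸ i) m)))))
            (by-cases (ℕ.<-cmp h ℓ))
      where
      lower : ℕ → ℤ
      lower i = β ^ (h ℕ.+ (ℓ ∸ i)) * shiftedCpow (suc (h ℕ.+ ((ℓ ∸ i) ℕ.+ (ℓ ∸ i)))) (suc (h ℕ.+ ((ℓ ∸ i) ℕ.+ (ℓ ∸ i)))) m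
      ∸-suc : ∀ l h → h < l → l ∸ h ≡ suc (l ∸ suc h)
      ∸-suc (suc l) h (s≤s h≤l) = ℕ.+-∸-assoc 1 h≤l
      lower≡peakTerm : h < ℓ → lower h ≡ peakTerm (suc h) (ℓ ∸ suc h) m
      lower≡peakTerm h<ℓ rewrite ∸-suc ℓ h h<ℓ =
        cong₂ (λ u v → β ^ u * shiftedCpow v v m) (ℕ.+-suc h (ℓ ∸ suc h)) (reassoc h (ℓ ∸ suc h))
        where
        reassoc : ∀ h t → suc (h ℕ.+ (suc t ℕ.+ suc t)) ≡ suc (suc (suc (h ℕ.+ (t ℕ.+ t))))
        reassoc = ℕ-Solver.solve-∀
      by-cases : Tri (h < ℓ) (h ≡ ℓ) (ℓ < h) →
        + a * (whenℤ (h <ᵇ k) (lower h) - whenℤ (suc h <ᵇ k) (peakTerm (suc h) (ℓ ∸ suc h) m)) ≡ new-peaks h m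
      by-cases (tri< h<ℓ _ _) rewrite <ᵇ-true (ℕ.m<n⇒m<1+n h<ℓ) | <ᵇ-true (s≤s h<ℓ) | lower≡peakTerm h<ℓ =
        trans (cong (+ a *_) (ℤ.+-inverseʳ (peakTerm (suc h) (ℓ ∸ suc h) m))) (trans (ℤ.*-zeroʳ (+ a)) (sym (no-peaks m)))
        where
        no-peaks : ∀ m → new-peaks h m ≡ + 0
        no-peaks zero    = refl
        no-peaks (suc m) rewrite ≡ᵇ-false (ℕ.<⇒≢ (s≤s h<ℓ)) = ℤ.*-zeroʳ (+ a)
      by-cases (tri≈ _ refl _) rewrite <ᵇ-true (ℕ.n<1+n h) | <ᵇ-false (ℕ.≤-refl {suc h}) | ℕ.n∸n≡0 h =
        trans (cong (+ a *_) (ℤ.+-identityʳ _)) (peaks-at-ℓ m)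
        where
        peaks-at-ℓ : ∀ m → + a * (β ^ (h ℕ.+ 0) * shiftedCpow (suc (h ℕ.+ 0)) (suc (h ℕ.+ 0)) m) ≡ new-peaks h m
        peaks-at-ℓ zero    = trans (cong (+ a *_) (ℤ.*-zeroʳ (β ^ (h ℕ.+ 0)))) (ℤ.*-zeroʳ (+ a))
        peaks-at-ℓ (suc m) rewrite ≡ᵇ-refl h | ℕ.+-identityʳ h = refl
      by-cases (tri> _ _ ℓ<h) rewrite <ᵇ-false ℓ<h | <ᵇ-false (ℕ.m≤n⇒m≤1+n ℓ<h) =
        trans (ℤ.*-zeroʳ (+ a)) (sym (no-peaks m))
        where
        no-peaks : ∀ m → new-peaks h m ≡ + 0
        no-peaks zero    = refl
        no-peaks (suc m) rewrite ≡ᵇ-false (ℕ.>⇒≢ (s≤s ℓ<h)) = ℤ.*-zeroʳ (+ a)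

    δ-sum : ∀ h m → + a * ∑ k (λ i → termδ h m i (ℓ ∸ i)) ≡ δ-term h m
    δ-sum h m = trans (cong (+ a *_) (sym (*-distribˡ-∑ k δ (inner m)))) (by-length m)
      where
      inner : ℕ → ℕ → ℤ
      inner m i = whenℤ (i ≤ᵇ h) (β ^ (h ℕ.+ (ℓ ∸ i)) * shiftedCpow (peakPower h (ℓ ∸ i)) (suc (suc (peakPower h (ℓ ∸ i)))) (suc m))
      swap : ∀ x y z → x * (y * z) ≡ y * (x * z)
      swap = solve-∀
      by-length : ∀ m → + a * (δ * ∑ k (inner m)) ≡ δ-term h m
      by-length zero    = trans (cong (λ z → + a * (δ * z)) (∑-zero k (λ i _ → whenℤ-*-zero (i ≤ᵇ h) (β ^ (h ℕ.+ (ℓ ∸ i))))))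
                                (trans (cong (+ a *_) (ℤ.*-zeroʳ δ)) (ℤ.*-zeroʳ (+ a)))
      by-length (suc m) = swap (+ a) δ (peakTerms h m)

    β-sum : ∀ h m → + a * ∑ k (λ i → termβ h m i (ℓ ∸ i)) ≡ β-term h m
    β-sum zero    m = trans (cong (+ a *_) (∑-zero k (λ _ _ → refl))) (ℤ.*-zeroʳ (+ a))
    β-sum (suc h) m = trans (cong (+ a *_) (sym (*-distribˡ-∑ k β (λ i → whenℤ (i ≤ᵇ h) (peakTerm h (ℓ ∸ i) m)))))
                            (swap (+ a) β (peakTerms h m))
      where
      swap : ∀ x y z → x * (y * z) ≡ y * (x * z)
      swap = solve-∀

  peakSum-suc : ∀ h m → peakSum h (suc m) ≡ peakSum (suc h) m + δ-term h m + β-term h m + new-peaks h m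
  peakSum-suc h m = begin
    + a * ∑ k (λ i → term h m i (ℓ ∸ i))
      ≡⟨ cong (+ a *_) (∑-cong k (λ i _ → term-split h m i (ℓ ∸ i))) ⟩
    + a * ∑ k (λ i → T↑ i + Tδ i + Tβ i + T∂ i)
      ≡⟨ cong (+ a *_) (trans (∑-distrib-+ k (λ i → T↑ i + Tδ i + Tβ i) T∂)
                       (cong (_+ ∑ k T∂) (trans (∑-distrib-+ k (λ i → T↑ i + Tδ i) Tβ)
                                                (cong (_+ ∑ k Tβ) (∑-distrib-+ k T↑ Tδ))))) ⟩
    + a * (∑ k T↑ + ∑ k Tδ + ∑ k Tβ + ∑ k T∂)
      ≡⟨ distrib₄ (+ a) (∑ k T↑) (∑ k Tδ) (∑ k Tβ) (∑ k T∂) ⟩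
    peakSum (suc h) m + + a * ∑ k Tδ + + a * ∑ k Tβ + + a * ∑ k T∂
      ≡⟨ cong₂ (λ u v → peakSum (suc h) m + u + v + + a * ∑ k T∂) (δ-sum h m) (β-sum h m) ⟩
    peakSum (suc h) m + δ-term h m + β-term h m + + a * ∑ k T∂
      ≡⟨ cong (_+_ (peakSum (suc h) m + δ-term h m + β-term h m)) (boundary-sum h m) ⟩
    peakSum (suc h) m + δ-term h m + β-term h m + new-peaks h m
      ∎
    where
    T↑ Tδ Tβ T∂ : ℕ → ℤ
    T↑ i = term↑ h m i (ℓ ∸ i)
    Tδ i = termδ h m i (ℓ ∸ i)
    Tβ i = termβ h m i (ℓ ∸ i)
    T∂ i = termBoundary h m i (ℓ ∸ i)
    distrib₄ : ∀ a w x y z → a * (w + x + y + z) ≡ a * w + a * x + a * y + a * z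
    distrib₄ = solve-∀

  #peaks-afterU : ∀ h m → + #peaks (suc h) true (suc m) ≡
    + #peaks (suc h) false (suc m) + (+ a * whenℤ (suc h ≡ᵇ k) (+ #paths h false m) + δ * + #peaks h false m)
  #peaks-afterU h m = begin
    + #peaks (suc h) true (suc m)
      ≡⟨ cong +_ (#peaks-suc h true m) ⟩
    + (#peaks (suc (suc h)) true m ℕ.+ a ℕ.* (when peak? (#paths h false m) ℕ.+ #peaks h false m))
      ≡⟨ pos-+-* (#peaks (suc (suc h)) true m) a _ ⟩
    + #peaks (suc (suc h)) true m + + a * + (when peak? (#paths h false m) ℕ.+ #peaks h false m)
      ≡⟨ cong (λ z → + #peaks (suc (suc h)) true m + + a * z)
              (trans (ℤ.pos-+ (when peak? (#paths h false m)) (#peaks h false m)) (cong (_+ + #peaks h false m) (pos-when peak? _))) ⟩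
    + #peaks (suc (suc h)) true m + + a * (whenℤ peak? (+ #paths h false m) + + #peaks h false m)
      ≡⟨ a≡b+δ (+ #peaks (suc (suc h)) true m) (+ a) β (whenℤ peak? (+ #paths h false m)) (+ #peaks h false m) ⟩
    + #peaks (suc (suc h)) true m + β * + #peaks h false m + (+ a * whenℤ peak? (+ #paths h false m) + δ * + #peaks h false m)
      ≡⟨ cong (_+ (+ a * whenℤ peak? (+ #paths h false m) + δ * + #peaks h false m))
              (trans (cong +_ (#peaks-suc h false m)) (pos-+-* (#peaks (suc (suc h)) true m) b (#peaks h false m))) ⟨
    + #peaks (suc h) false (suc m) + (+ a * whenℤ peak? (+ #paths h false m) + δ * + #peaks h false m)
      ∎
    where
    peak? : Bool
    peak? = suc h ≡ᵇ k
    a≡b+δ : ∀ x a b i p → x + a * (i + p) ≡ x + b * p + (a * i + (a - b) * p)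
    a≡b+δ = solve-∀

  peakSum-[] : ∀ h → peakSum h 0 ≡ + 0
  peakSum-[] h = trans (cong (+ a *_) (∑-zero k (λ i _ → whenℤ-*-zero (i ≤ᵇ h) (β ^ (h ℕ.+ (ℓ ∸ i)))))) (ℤ.*-zeroʳ (+ a))

  mutual
    #peaks≡peakSum : ∀ m h → + #peaks h false m ≡ peakSum h m
    #peaks≡peakSum zero    h       = trans (cong +_ (#peaks-[] h false)) (sym (peakSum-[] h))
    #peaks≡peakSum (suc m) zero    = begin
      + #peaks 0 false (suc m)                               ≡⟨ cong +_ (#peaks-from-0 false m) ⟩
      + #peaks 1 true m                                      ≡⟨ #peaks-afterU≡ m 0 ⟩
      peakSum 1 m + δ-term 0 m + new-peaks 0 m               ≡⟨ insert-zero (peakSum 1 m) (δ-term 0 m) (new-peaks 0 m) ⟩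
      peakSum 1 m + δ-term 0 m + β-term 0 m + new-peaks 0 m  ≡⟨ peakSum-suc 0 m ⟨
      peakSum 0 (suc m)                                      ∎
      where
      insert-zero : ∀ x y z → x + y + z ≡ x + y + + 0 + z
      insert-zero = solve-∀
    #peaks≡peakSum (suc m) (suc h) = begin
      + #peaks (suc h) false (suc m)
        ≡⟨ trans (cong +_ (#peaks-suc h false m)) (pos-+-* (#peaks (suc (suc h)) true m) b (#peaks h false m)) ⟩
      + #peaks (suc (suc h)) true m + β * + #peaks h false m
        ≡⟨ cong₂ (λ u v → u + β * v) (#peaks-afterU≡ m (suc h)) (#peaks≡peakSum m h) ⟩
      peakSum (suc (suc h)) m + δ-term (suc h) m + new-peaks (suc h) m + β * peakSum h m
        ≡⟨ swap (peakSum (suc (suc h)) m) (δ-term (suc h) m) (new-peaks (suc h) m) (β * peakSum h m) ⟩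
      peakSum (suc (suc h)) m + δ-term (suc h) m + β-term (suc h) m + new-peaks (suc h) m
        ≡⟨ peakSum-suc (suc h) m ⟨
      peakSum (suc h) (suc m)
        ∎
      where
      swap : ∀ x y z w → x + y + z + w ≡ x + y + w + z
      swap = solve-∀

    #peaks-afterU≡ : ∀ m h → + #peaks (suc h) true m ≡ peakSum (suc h) m + δ-term h m + new-peaks h m
    #peaks-afterU≡ zero    h = trans (cong +_ (#peaks-[] (suc h) true)) (sym (cong (λ z → z + + 0 + + 0) (peakSum-[] (suc h))))
    #peaks-afterU≡ (suc m) h = begin
      + #peaks (suc h) true (suc m)
        ≡⟨ #peaks-afterU h m ⟩
      + #peaks (suc h) false (suc m) + (+ a * whenℤ (suc h ≡ᵇ k) (+ #paths h false m) + δ * + #peaks h false m)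
        ≡⟨ cong₂ _+_ (#peaks≡peakSum (suc m) (suc h))
                     (cong₂ (λ u v → + a * whenℤ (suc h ≡ᵇ k) u + δ * v) (#paths≡ m h) (#peaks≡peakSum m h)) ⟩
      peakSum (suc h) (suc m) + (new-peaks h (suc m) + δ-term h (suc m))
        ≡⟨ swap (peakSum (suc h) (suc m)) (new-peaks h (suc m)) (δ-term h (suc m)) ⟩
      peakSum (suc h) (suc m) + δ-term h (suc m) + new-peaks h (suc m)
        ∎
      where
      swap : ∀ x y z → x + (y + z) ≡ x + z + y
      swap = solve-∀

  peakSum-from-0 : ∀ m → peakSum 0 m ≡ + a * (β ^ ℓ * shiftedCpow (peakPower 0 ℓ) (peakPower 0 ℓ) m)
  peakSum-from-0 m = cong (+ a *_) (trans (cong (_+_ (peakTerm 0 ℓ m)) (∑-zero ℓ (λ _ _ → refl))) (ℤ.+-identityʳ (peakTerm 0 ℓ m)))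

  total-peaks≡cpow : ∀ n → ℓ ≤ n → + p a b n ℓ ≡ + a * (β ^ ℓ * cpow (suc (suc (double ℓ))) (double (n ∸ ℓ)))
  total-peaks≡cpow n ℓ≤n = begin
    + p a b n ℓ                                    ≡⟨ cong +_ (total-peaks≡#peaks L) ⟩
    + #peaks 0 false L                             ≡⟨ #peaks≡peakSum L 0 ⟩
    peakSum 0 L                                    ≡⟨ peakSum-from-0 L ⟩
    + a * (β ^ ℓ * shiftedCpow R R L)              ≡⟨ cong (λ z → + a * (β ^ ℓ * z)) (trans (cong (shiftedCpow R R) L≡R+2N) (shiftedCpow-+ R R (double N))) ⟩
    + a * (β ^ ℓ * cpow R (double N))              ≡⟨ cong (λ r → + a * (β ^ ℓ * cpow (suc (suc r)) (double N))) (double≡+ ℓ) ⟨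
    + a * (β ^ ℓ * cpow (suc (suc (double ℓ))) (double N)) ∎
    where
    N L R : ℕ
    N = n ∸ ℓ
    L = 2 ℕ.* n ℕ.+ 2
    R = peakPower 0 ℓ
    arith : ∀ l N → 2 ℕ.* (l ℕ.+ N) ℕ.+ 2 ≡ suc (suc (l ℕ.+ l)) ℕ.+ (N ℕ.+ N)
    arith = ℕ-Solver.solve-∀
    L≡R+2N : L ≡ R ℕ.+ double N
    L≡R+2N = trans (cong (λ z → 2 ℕ.* z ℕ.+ 2) (sym (ℕ.m+[n∸m]≡n ℓ≤n))) (trans (arith ℓ N) (cong (R ℕ.+_) (sym (double≡+ N))))

module Binomial where
  open import Data.Nat using (_+_; _*_)
  open import Data.Nat.Combinatorics using (_C_; nCk+nC[k+1]≡[n+1]C[k+1]; nC1≡n)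
  import Data.Nat.Tactic.RingSolver as ℕ-Solver

  [1+k]*[1+n]C[1+k]≡[1+n]*nCk : ∀ n k → suc k * (suc n C suc k) ≡ suc n * (n C k)
  [1+k]*[1+n]C[1+k]≡[1+n]*nCk zero    zero    = refl
  [1+k]*[1+n]C[1+k]≡[1+n]*nCk zero    (suc k) = ℕ.*-zeroʳ (suc (suc k))
  [1+k]*[1+n]C[1+k]≡[1+n]*nCk (suc n) zero    = trans (ℕ.*-identityˡ _) (trans (nC1≡n (suc (suc n))) (sym (ℕ.*-identityʳ _)))
  [1+k]*[1+n]C[1+k]≡[1+n]*nCk (suc n) (suc k) = begin
    suc (suc k) * (suc (suc n) C suc (suc k))
      ≡⟨ cong (suc (suc k) *_) (nCk+nC[k+1]≡[n+1]C[k+1] (suc n) (suc k)) ⟨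
    suc (suc k) * (suc n C suc k + suc n C suc (suc k))
      ≡⟨ split (suc k) (suc n C suc k) (suc n C suc (suc k)) ⟩
    suc k * (suc n C suc k) + suc n C suc k + suc (suc k) * (suc n C suc (suc k))
      ≡⟨ cong₂ (λ u v → u + suc n C suc k + v) ([1+k]*[1+n]C[1+k]≡[1+n]*nCk n k) ([1+k]*[1+n]C[1+k]≡[1+n]*nCk n (suc k)) ⟩
    suc n * (n C k) + suc n C suc k + suc n * (n C suc k)
      ≡⟨ cong (λ z → suc n * (n C k) + z + suc n * (n C suc k)) (nCk+nC[k+1]≡[n+1]C[k+1] n k) ⟨
    suc n * (n C k) + (n C k + n C suc k) + suc n * (n C suc k)
      ≡⟨ collect n (n C k) (n C suc k) ⟩
    suc (suc n) * (n C k + n C suc k)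
      ≡⟨ cong (suc (suc n) *_) (nCk+nC[k+1]≡[n+1]C[k+1] n k) ⟩
    suc (suc n) * (suc n C suc k)
      ∎
    where
    split : ∀ k x y → suc k * (x + y) ≡ k * x + x + suc k * y
    split = ℕ-Solver.solve-∀
    collect : ∀ n x y → suc n * x + (x + y) + suc n * y ≡ suc (suc n) * (x + y)
    collect = ℕ-Solver.solve-∀

  [1+n]*nCk+k*[1+n]Ck≡[1+n]*[1+n]Ck : ∀ n k → suc n * (n C k) + k * (suc n C k) ≡ suc n * (suc n C k)
  [1+n]*nCk+k*[1+n]Ck≡[1+n]*[1+n]Ck n zero    = ℕ.+-identityʳ _
  [1+n]*nCk+k*[1+n]Ck≡[1+n]*[1+n]Ck n (suc k) = begin
    suc n * (n C suc k) + suc k * (suc n C suc k)  ≡⟨ cong (suc n * (n C suc k) +_) ([1+k]*[1+n]C[1+k]≡[1+n]*nCk n k) ⟩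
    suc n * (n C suc k) + suc n * (n C k)          ≡⟨ factor (suc n) (n C suc k) (n C k) ⟩
    suc n * (n C k + n C suc k)                    ≡⟨ cong (suc n *_) (nCk+nC[k+1]≡[n+1]C[k+1] n k) ⟩
    suc n * (suc n C suc k)                        ∎
    where
    factor : ∀ a x y → a * x + a * y ≡ a * (y + x)
    factor = ℕ-Solver.solve-∀

module ExpansionCoefficients where
  open import Data.Empty using (⊥-elim)
  open import Data.Nat using (_+_; _*_)
  open import Data.Nat.Combinatorics using (_C_)
  open import Data.Nat.Tactic.RingSolver using (solve-∀)
  open Binomial

  -- cpowCoeff r j m is the coefficient of δ^j β^m in cpow r (double (j + m)), see cpow≡expansion.
  cpowCoeff : ℕ → ℕ → ℕ → ℕ
  cpowCoeff zero    zero    zero    = 1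
  cpowCoeff zero    zero    (suc m) = 0
  cpowCoeff zero    (suc j) m       = 0
  cpowCoeff (suc r) zero    zero    = cpowCoeff r 0 0
  cpowCoeff (suc r) (suc j) zero    = cpowCoeff r (suc j) 0 + cpowCoeff (suc r) j 0
  cpowCoeff (suc r) zero    (suc m) = cpowCoeff r 0 (suc m) + cpowCoeff (suc (suc r)) 0 m
  cpowCoeff (suc r) (suc j) (suc m) = cpowCoeff r (suc j) (suc m) + cpowCoeff (suc r) j (suc m) + cpowCoeff (suc (suc r)) (suc j) m

  viaδ viaβ : ℕ → ℕ → ℕ → ℕ
  viaδ r zero    m       = 0
  viaδ r (suc j) m       = cpowCoeff (suc r) j m
  viaβ r j       zero    = 0
  viaβ r j       (suc m) = cpowCoeff (suc (suc r)) j m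

  cpowCoeff-suc : ∀ r j m → cpowCoeff (suc r) j m ≡ cpowCoeff r j m + viaδ r j m + viaβ r j m
  cpowCoeff-suc r zero    zero    = sym (trans (ℕ.+-identityʳ _) (ℕ.+-identityʳ _))
  cpowCoeff-suc r (suc j) zero    = sym (ℕ.+-identityʳ _)
  cpowCoeff-suc r zero    (suc m) = cong (_+ cpowCoeff (suc (suc r)) 0 m) (sym (ℕ.+-identityʳ _))
  cpowCoeff-suc r (suc j) (suc m) = refl

  cpowCoeff-r-0-0 : ∀ r → cpowCoeff r 0 0 ≡ 1
  cpowCoeff-r-0-0 zero    = refl
  cpowCoeff-r-0-0 (suc r) = cpowCoeff-r-0-0 r

  private
    closed-viaδ : ∀ K N j G R → K * G ≡ R * (K C N) * (N C j) →
      suc K * suc N * (K * G) ≡ R * (suc N * (suc K C suc N)) * (suc j * (suc N C suc j))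
    closed-viaδ K N j G R hyp = begin
      suc K * suc N * (K * G)                            ≡⟨ cong (suc K * suc N *_) hyp ⟩
      suc K * suc N * (R * (K C N) * (N C j))            ≡⟨ regroup (suc K) (suc N) R (K C N) (N C j) ⟩
      R * (suc K * (K C N)) * (suc N * (N C j))          ≡⟨ cong₂ (λ u v → R * u * v) ([1+k]*[1+n]C[1+k]≡[1+n]*nCk K N)
                                                                                    ([1+k]*[1+n]C[1+k]≡[1+n]*nCk N j) ⟨
      R * (suc N * (suc K C suc N)) * (suc j * (suc N C suc j)) ∎
      where
      regroup : ∀ a b c x z → a * b * (c * x * z) ≡ c * (a * x) * (b * z)
      regroup = solve-∀

    closed-viaβ : ∀ K N j m G R → suc N ≡ j + suc m → K * G ≡ R * (K C N) * (N C j) →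
      suc K * suc N * (K * G) ≡ R * (suc N * (suc K C suc N)) * (suc m * (suc N C j))
    closed-viaβ K N j m G R N≡j+m hyp = begin
      suc K * suc N * (K * G)                            ≡⟨ cong (suc K * suc N *_) hyp ⟩
      suc K * suc N * (R * (K C N) * (N C j))            ≡⟨ regroup (suc K) (suc N) R (K C N) (N C j) ⟩
      R * (suc K * (K C N)) * (suc N * (N C j))          ≡⟨ cong₂ (λ u v → R * u * v) (sym ([1+k]*[1+n]C[1+k]≡[1+n]*nCk K N)) absorb ⟩
      R * (suc N * (suc K C suc N)) * (suc m * (suc N C j)) ∎
      where
      regroup : ∀ a b c x z → a * b * (c * x * z) ≡ c * (a * x) * (b * z)
      regroup = solve-∀
      Z : ℕ
      Z = suc N C j
      absorb : suc N * (N C j) ≡ suc m * Z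
      absorb = ℕ.+-cancelʳ-≡ (j * Z) _ _ (begin
        suc N * (N C j) + j * Z ≡⟨ [1+n]*nCk+k*[1+n]Ck≡[1+n]*[1+n]Ck N j ⟩
        suc N * Z               ≡⟨ cong (_* Z) N≡j+m ⟩
        (j + suc m) * Z         ≡⟨ trans (ℕ.*-distribʳ-+ Z j (suc m)) (ℕ.+-comm (j * Z) (suc m * Z)) ⟩
        suc m * Z + j * Z       ∎)

    closed-vanishing : ∀ L N K R Y Z → L * N * (K * 0) ≡ R * (N * Y) * (0 * Z)
    closed-vanishing L N K R Y Z =
      trans (cong (L * N *_) (ℕ.*-zeroʳ K)) (trans (ℕ.*-zeroʳ (L * N)) (sym (ℕ.*-zeroʳ (R * (N * Y)))))

    -- Multiplied by (K+1)·N·K the claim becomes a polynomial identity in the hypotheses; the summand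
    -- `extra` on both sides lets (K+1)·C(K,N) + N·C(K+1,N) = (K+1)·C(K+1,N) enter without subtraction.
    closed-step : ∀ r j m K N G₀ Gδ Gβ → suc N ≡ j + m → K ≡ r + (j + (m + m)) →
      K * G₀ ≡ r * (K C suc N) * (suc N C j) →
      suc K * suc N * (K * Gδ) ≡ suc r * (suc N * (suc K C suc N)) * (j * (suc N C j)) →
      suc K * suc N * (K * Gβ) ≡ suc (suc r) * (suc N * (suc K C suc N)) * (m * (suc N C j)) →
      suc K * (G₀ + Gδ + Gβ) ≡ suc r * (suc K C suc N) * (suc N C j)
    closed-step r j m zero N _ _ _ N≡j+m 0≡K _ _ _ = ⊥-elim (ℕ.0≢1+n (trans (sym j+m≡0) (sym N≡j+m)))
      where
      j+2m≡0 : j + (m + m) ≡ 0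
      j+2m≡0 = ℕ.m+n≡0⇒n≡0 r (sym 0≡K)
      j+m≡0 : j + m ≡ 0
      j+m≡0 = cong₂ _+_ (ℕ.m+n≡0⇒m≡0 j j+2m≡0) (ℕ.m+n≡0⇒m≡0 m (ℕ.m+n≡0⇒n≡0 j j+2m≡0))
    closed-step r j m K@(suc _) N′ G₀ Gδ Gβ N≡j+m K≡r+j+2m h₀ hδ hβ =
      ℕ.*-cancelˡ-≡ _ _ (L * N * K) (ℕ.+-cancelʳ-≡ extra _ _ (begin
        L * N * K * (L * (G₀ + Gδ + Gβ)) + extra
          ≡⟨ cong (_+ extra) (expand L N K G₀ Gδ Gβ) ⟩
        L * L * N * (K * G₀) + L * (L * N * (K * Gδ)) + L * (L * N * (K * Gβ)) + extra
          ≡⟨ cong (λ u → L * L * N * u + L * (L * N * (K * Gδ)) + L * (L * N * (K * Gβ)) + extra) h₀ ⟩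
        L * L * N * (r * X * Z) + L * (L * N * (K * Gδ)) + L * (L * N * (K * Gβ)) + extra
          ≡⟨ cong₂ (λ u v → L * L * N * (r * X * Z) + L * u + L * v + extra) hδ hβ ⟩
        L * L * N * (r * X * Z) + L * (suc r * (N * Y) * (j * Z)) + L * (suc (suc r) * (N * Y) * (m * Z)) + extra
          ≡⟨ collect L N r X Y Z _ _ ⟩
        L * N * r * Z * (L * X + N * Y) + L * (suc r * (N * Y) * (j * Z)) + L * (suc (suc r) * (N * Y) * (m * Z))
          ≡⟨ cong (λ z → L * N * r * Z * z + L * (suc r * (N * Y) * (j * Z)) + L * (suc (suc r) * (N * Y) * (m * Z)))
                  ([1+n]*nCk+k*[1+n]Ck≡[1+n]*[1+n]Ck K N) ⟩
        L * N * r * Z * (L * Y) + L * (suc r * (N * Y) * (j * Z)) + L * (suc (suc r) * (N * Y) * (m * Z))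
          ≡⟨ final N K N≡j+m K≡r+j+2m ⟩
        L * N * K * (suc r * Y * Z) + extra
          ∎))
      where
      L N X Y Z extra : ℕ
      L = suc K
      N = suc N′
      X = K C N
      Y = L C N
      Z = N C j
      extra = L * N * r * Z * (N * Y)
      expand : ∀ l n k g₀ gδ gβ →
        l * n * k * (l * (g₀ + gδ + gβ)) ≡ l * l * n * (k * g₀) + l * (l * n * (k * gδ)) + l * (l * n * (k * gβ))
      expand = solve-∀
      collect : ∀ l n r x y z u v →
        l * l * n * (r * x * z) + u + v + l * n * r * z * (n * y) ≡ l * n * r * z * (l * x + n * y) + u + v
      collect = solve-∀
      polynomial : ∀ r j m Y Z →
        let L = suc (r + (j + (m + m))) ; N = j + m ; K = r + (j + (m + m)) in
        L * N * r * Z * (L * Y) + L * (suc r * (N * Y) * (j * Z)) + L * (suc (suc r) * (N * Y) * (m * Z))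
        ≡ L * N * K * (suc r * Y * Z) + L * N * r * Z * (N * Y)
      polynomial = solve-∀
      final : ∀ N K → N ≡ j + m → K ≡ r + (j + (m + m)) →
        suc K * N * r * Z * (suc K * Y) + suc K * (suc r * (N * Y) * (j * Z)) + suc K * (suc (suc r) * (N * Y) * (m * Z))
        ≡ suc K * N * K * (suc r * Y * Z) + suc K * N * r * Z * (N * Y)
      final _ _ refl refl = polynomial r j m Y Z

  cpowCoeff-closed : ∀ r j m K N → K ≡ r + (j + (m + m)) → N ≡ j + m →
    K * cpowCoeff r j m ≡ r * (K C N) * (N C j)
  cpowCoeff-closed zero    zero    zero    K N refl refl = refl
  cpowCoeff-closed zero    zero    (suc m) K N _    _    = ℕ.*-zeroʳ K
  cpowCoeff-closed zero    (suc j) m       K N _    _    = ℕ.*-zeroʳ K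
  cpowCoeff-closed (suc r) zero    zero    K N refl refl = begin
    suc (r + 0) * cpowCoeff r 0 0  ≡⟨ cong (suc (r + 0) *_) (cpowCoeff-r-0-0 r) ⟩
    suc (r + 0) * 1                ≡⟨ cong (λ z → suc z * 1) (ℕ.+-identityʳ r) ⟩
    suc r * 1                      ≡⟨ ℕ.*-identityʳ (suc r * 1) ⟨
    suc r * 1 * 1                  ∎
  cpowCoeff-closed (suc r) (suc j) zero    K N refl refl =
    trans (cong (suc K′ *_) (cpowCoeff-suc r (suc j) 0))
      (closed-step r (suc j) 0 K′ (j + 0) _ _ _ refl refl
        (cpowCoeff-closed r (suc j) 0 K′ (suc j + 0) refl refl)
        (closed-viaδ K′ (j + 0) j _ (suc r) (cpowCoeff-closed (suc r) j 0 K′ (j + 0) (ℕ.+-suc r (j + 0)) refl))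
        (closed-vanishing (suc K′) (suc (j + 0)) K′ (suc (suc r)) (suc K′ C suc (j + 0)) (suc (j + 0) C suc j)))
    where
    K′ : ℕ
    K′ = r + (suc j + (0 + 0))
  cpowCoeff-closed (suc r) zero    (suc m) K N refl refl =
    trans (cong (suc K′ *_) (cpowCoeff-suc r 0 (suc m)))
      (closed-step r 0 (suc m) K′ m _ _ _ refl refl
        (cpowCoeff-closed r 0 (suc m) K′ (suc m) refl refl)
        (closed-vanishing (suc K′) (suc m) K′ (suc r) (suc K′ C suc m) (suc m C 0))
        (closed-viaβ K′ m 0 m _ (suc (suc r)) refl (cpowCoeff-closed (suc (suc r)) 0 m K′ m (shift r m) refl)))
    where
    K′ : ℕ
    K′ = r + (0 + (suc m + suc m))
    shift : ∀ r m → r + (0 + (suc m + suc m)) ≡ suc (suc r) + (0 + (m + m))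
    shift = solve-∀
  cpowCoeff-closed (suc r) (suc j) (suc m) K N refl refl =
    trans (cong (suc K′ *_) (cpowCoeff-suc r (suc j) (suc m)))
      (closed-step r (suc j) (suc m) K′ (j + suc m) _ _ _ refl refl
        (cpowCoeff-closed r (suc j) (suc m) K′ (suc j + suc m) refl refl)
        (closed-viaδ K′ (j + suc m) j _ (suc r)
          (cpowCoeff-closed (suc r) j (suc m) K′ (j + suc m) (ℕ.+-suc r (j + (suc m + suc m))) refl))
        (closed-viaβ K′ (j + suc m) (suc j) m _ (suc (suc r)) refl
          (cpowCoeff-closed (suc (suc r)) (suc j) m K′ (j + suc m) (shift r j m) (ℕ.+-suc j m))))
    where
    K′ : ℕ
    K′ = r + (suc j + (suc m + suc m))
    shift : ∀ r j m → r + (suc j + (suc m + suc m)) ≡ suc (suc r) + (suc j + (m + m))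
    shift = solve-∀

module Fractions where
  open import Data.Integer using (ℤ; +_; _+_; _*_)
  open import Data.Integer.Tactic.RingSolver using (solve-∀)
  open import Data.List using (map; applyUpTo; foldr)
  open import Data.Rational as ℚ using (ℚ; _/_; 0ℚ)
  import Data.Rational.Properties as ℚ
  import Data.Rational.Unnormalised as ℚᵘ
  import Data.Rational.Unnormalised.Properties as ℚᵘ

  *-/-cancelˡ : ∀ M z → (+ suc M * z) / suc M ≡ z / 1
  *-/-cancelˡ M z = ℚ.fromℚᵘ-cong {ℚᵘ.mkℚᵘ (+ suc M * z) M} {ℚᵘ.mkℚᵘ z 0} (ℚᵘ.*≡* (cross (+ suc M) z))
    where
    cross : ∀ m z → m * z * + 1 ≡ z * m
    cross = solve-∀

  /1-homo-+ : ∀ x y → (x / 1) ℚ.+ (y / 1) ≡ (x + y) / 1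
  /1-homo-+ x y = ℚ.toℚᵘ-injective (ℚᵘ.≃-trans (ℚ.toℚᵘ-homo-+ (x / 1) (y / 1))
    (ℚᵘ.≃-trans (ℚᵘ.+-cong (ℚ.toℚᵘ-fromℚᵘ (ℚᵘ.mkℚᵘ x 0)) (ℚ.toℚᵘ-fromℚᵘ (ℚᵘ.mkℚᵘ y 0)))
      (ℚᵘ.≃-trans (ℚᵘ.*≡* (cross x y)) (ℚᵘ.≃-sym (ℚ.toℚᵘ-fromℚᵘ (ℚᵘ.mkℚᵘ (x + y) 0))))))
    where
    cross : ∀ x y → (x * + 1 + y * + 1) * + 1 ≡ (x + y) * (+ 1 * + 1)
    cross = solve-∀

  foldr-+-/1 : ∀ K (g : ℕ → ℕ) (f : ℕ → ℚ) (z : ℕ → ℤ) → (∀ j → j < K → f (g j) ≡ z j / 1) →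
    foldr ℚ._+_ 0ℚ (map f (applyUpTo g K)) ≡ ∑ K z / 1
  foldr-+-/1 zero    g f z f≡z = refl
  foldr-+-/1 (suc K) g f z f≡z = begin
    f (g 0) ℚ.+ foldr ℚ._+_ 0ℚ (map f (applyUpTo (g ∘ suc) K))
      ≡⟨ cong₂ ℚ._+_ (f≡z 0 (s≤s z≤n)) (foldr-+-/1 K (g ∘ suc) f (z ∘ suc) (λ j j<K → f≡z (suc j) (s≤s j<K))) ⟩
    (z 0 / 1) ℚ.+ (∑ K (z ∘ suc) / 1)
      ≡⟨ /1-homo-+ (z 0) _ ⟩
    ∑ (suc K) z / 1
      ∎

module ExplicitFormula (a b : ℕ) where
  open import Data.Integer using (ℤ; +_; _+_; _*_; _^_)
  import Data.Integer.Properties as ℤ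
  open import Data.Integer.Tactic.RingSolver using (solve-∀)
  open import Data.Nat.Combinatorics using (_C_)
  import Data.Nat.Tactic.RingSolver as ℕ-Solver
  open import Data.Rational using (_/_)
  open Coefficients a b
  open ExpansionCoefficients
  open Fractions

  weightedSum : (ℕ → ℕ → ℕ) → ℕ → ℤ
  weightedSum c N = ∑ (suc N) (λ j → δ ^ j * β ^ (N ∸ j) * + c j (N ∸ j))

  expansion : ℕ → ℕ → ℤ
  expansion r = weightedSum (cpowCoeff r)

  weightedSum-+ : ∀ c₁ c₂ N → weightedSum (λ j m → c₁ j m ℕ.+ c₂ j m) N ≡ weightedSum c₁ N + weightedSum c₂ N
  weightedSum-+ c₁ c₂ N = trans (∑-cong (suc N) (λ j _ → distrib j)) (∑-distrib-+ (suc N) (term c₁) (term c₂))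
    where
    term : (ℕ → ℕ → ℕ) → ℕ → ℤ
    term c j = δ ^ j * β ^ (N ∸ j) * + c j (N ∸ j)
    distrib : ∀ j → δ ^ j * β ^ (N ∸ j) * + (c₁ j (N ∸ j) ℕ.+ c₂ j (N ∸ j)) ≡ term c₁ j + term c₂ j
    distrib j = trans (cong (δ ^ j * β ^ (N ∸ j) *_) (ℤ.pos-+ (c₁ j (N ∸ j)) (c₂ j (N ∸ j))))
                      (ℤ.*-distribˡ-+ (δ ^ j * β ^ (N ∸ j)) _ _)

  weightedSum-viaδ : ∀ r N → weightedSum (viaδ r) (suc N) ≡ δ * expansion (suc r) N
  weightedSum-viaδ r N = begin
    δ ^ 0 * β ^ suc N * + 0 + ∑ (suc N) (λ j → δ ^ suc j * β ^ (N ∸ j) * + cpowCoeff (suc r) j (N ∸ j))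
      ≡⟨ cong₂ _+_ (ℤ.*-zeroʳ (δ ^ 0 * β ^ suc N)) (∑-cong (suc N) (λ j _ → pull δ (δ ^ j) (β ^ (N ∸ j)) (+ cpowCoeff (suc r) j (N ∸ j)))) ⟩
    + 0 + ∑ (suc N) (λ j → δ * (δ ^ j * β ^ (N ∸ j) * + cpowCoeff (suc r) j (N ∸ j)))
      ≡⟨ ℤ.+-identityˡ _ ⟩
    ∑ (suc N) (λ j → δ * (δ ^ j * β ^ (N ∸ j) * + cpowCoeff (suc r) j (N ∸ j)))
      ≡⟨ *-distribˡ-∑ (suc N) δ (λ j → δ ^ j * β ^ (N ∸ j) * + cpowCoeff (suc r) j (N ∸ j)) ⟨
    δ * expansion (suc r) N
      ∎
    where
    pull : ∀ x y z w → x * y * z * w ≡ x * (y * z * w)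
    pull = solve-∀

  weightedSum-viaβ : ∀ r N → weightedSum (viaβ r) (suc N) ≡ β * expansion (suc (suc r)) N
  weightedSum-viaβ r N = begin
    ∑ (suc (suc N)) term
      ≡⟨ ∑-init-last (suc N) term ⟩
    ∑ (suc N) term + term (suc N)
      ≡⟨ cong₂ _+_ (∑-cong (suc N) term≡)
                   (trans (cong (λ z → δ ^ suc N * β ^ z * + viaβ r (suc N) z) (ℕ.n∸n≡0 N)) (ℤ.*-zeroʳ (δ ^ suc N * β ^ 0))) ⟩
    ∑ (suc N) (λ j → β * (δ ^ j * β ^ (N ∸ j) * + cpowCoeff (suc (suc r)) j (N ∸ j))) + + 0
      ≡⟨ ℤ.+-identityʳ _ ⟩
    ∑ (suc N) (λ j → β * (δ ^ j * β ^ (N ∸ j) * + cpowCoeff (suc (suc r)) j (N ∸ j)))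
      ≡⟨ *-distribˡ-∑ (suc N) β (λ j → δ ^ j * β ^ (N ∸ j) * + cpowCoeff (suc (suc r)) j (N ∸ j)) ⟨
    β * expansion (suc (suc r)) N
      ∎
    where
    term : ℕ → ℤ
    term j = δ ^ j * β ^ (suc N ∸ j) * + viaβ r j (suc N ∸ j)
    pull : ∀ x y z w → x * (y * z) * w ≡ y * (x * z * w)
    pull = solve-∀
    term≡ : ∀ j → j < suc N → term j ≡ β * (δ ^ j * β ^ (N ∸ j) * + cpowCoeff (suc (suc r)) j (N ∸ j))
    term≡ j (s≤s j≤N) rewrite ℕ.+-∸-assoc 1 j≤N = pull (δ ^ j) β (β ^ (N ∸ j)) _

  expansion-suc : ∀ r N →
    expansion (suc r) (suc N) ≡ expansion r (suc N) + δ * expansion (suc r) N + β * expansion (suc (suc r)) N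
  expansion-suc r N = begin
    expansion (suc r) (suc N)
      ≡⟨ ∑-cong (suc (suc N)) (λ j _ → cong (λ z → δ ^ j * β ^ (suc N ∸ j) * + z) (cpowCoeff-suc r j (suc N ∸ j))) ⟩
    weightedSum (λ j m → cpowCoeff r j m ℕ.+ viaδ r j m ℕ.+ viaβ r j m) (suc N)
      ≡⟨ weightedSum-+ (λ j m → cpowCoeff r j m ℕ.+ viaδ r j m) (viaβ r) (suc N) ⟩
    weightedSum (λ j m → cpowCoeff r j m ℕ.+ viaδ r j m) (suc N) + weightedSum (viaβ r) (suc N)
      ≡⟨ cong (_+ weightedSum (viaβ r) (suc N)) (weightedSum-+ (cpowCoeff r) (viaδ r) (suc N)) ⟩
    expansion r (suc N) + weightedSum (viaδ r) (suc N) + weightedSum (viaβ r) (suc N)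
      ≡⟨ cong₂ (λ u v → expansion r (suc N) + u + v) (weightedSum-viaδ r N) (weightedSum-viaβ r N) ⟩
    expansion r (suc N) + δ * expansion (suc r) N + β * expansion (suc (suc r)) N
      ∎

  cpow≡expansion : ∀ r N → cpow r (double N) ≡ expansion r N
  cpow≡expansion zero    zero    = refl
  cpow≡expansion zero    (suc N) = sym (begin
    δ ^ 0 * β ^ suc N * + 0 + ∑ (suc N) (λ j → δ ^ suc j * β ^ (N ∸ j) * + 0)
      ≡⟨ cong₂ _+_ (ℤ.*-zeroʳ (δ ^ 0 * β ^ suc N)) (∑-zero (suc N) (λ j _ → ℤ.*-zeroʳ (δ ^ suc j * β ^ (N ∸ j)))) ⟩
    + 0 ∎)
  cpow≡expansion (suc r) zero    =
    sym (trans (ℤ.+-identityʳ _) (cong (λ z → + 1 * + 1 * + z) (cpowCoeff-r-0-0 (suc r))))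
  cpow≡expansion (suc r) (suc N) = begin
    cpow r (double (suc N)) + δ * cpow (suc r) (double N) + β * cpow (suc (suc r)) (double N)
      ≡⟨ cong₂ _+_ (cong₂ _+_ (cpow≡expansion r (suc N)) (cong (δ *_) (cpow≡expansion (suc r) N)))
                   (cong (β *_) (cpow≡expansion (suc (suc r)) N)) ⟩
    expansion r (suc N) + δ * expansion (suc r) N + β * expansion (suc (suc r)) N
      ≡⟨ expansion-suc r N ⟨
    expansion (suc r) (suc N)
      ∎

  private
    weighted-binomials : ∀ ℓ j m M N → M ≡ suc (suc (double ℓ)) ℕ.+ (j ℕ.+ (m ℕ.+ m)) → N ≡ j ℕ.+ m →
      2 ℕ.* a ℕ.* suc ℓ ℕ.* (M C N) ℕ.* (N C j) ≡ M ℕ.* (a ℕ.* cpowCoeff (suc (suc (double ℓ))) j m)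
    weighted-binomials ℓ j m M N M≡ N≡ = begin
      2 ℕ.* a ℕ.* suc ℓ ℕ.* (M C N) ℕ.* (N C j)
        ≡⟨ cong (λ z → z ℕ.* (M C N) ℕ.* (N C j)) (trans (double-a a ℓ) (cong (λ z → a ℕ.* suc (suc z)) (sym (double≡+ ℓ)))) ⟩
      a ℕ.* r ℕ.* (M C N) ℕ.* (N C j)        ≡⟨ reassoc a r (M C N) (N C j) ⟩
      a ℕ.* (r ℕ.* (M C N) ℕ.* (N C j))      ≡⟨ cong (a ℕ.*_) (cpowCoeff-closed r j m M N M≡ N≡) ⟨
      a ℕ.* (M ℕ.* cpowCoeff r j m)          ≡⟨ swap a M (cpowCoeff r j m) ⟩
      M ℕ.* (a ℕ.* cpowCoeff r j m)          ∎
      where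
      r = suc (suc (double ℓ))
      double-a : ∀ a l → 2 ℕ.* a ℕ.* suc l ≡ a ℕ.* suc (suc (l ℕ.+ l))
      double-a = ℕ-Solver.solve-∀
      reassoc : ∀ a r x y → a ℕ.* r ℕ.* x ℕ.* y ≡ a ℕ.* (r ℕ.* x ℕ.* y)
      reassoc = ℕ-Solver.solve-∀
      swap : ∀ a M q → a ℕ.* (M ℕ.* q) ≡ M ℕ.* (a ℕ.* q)
      swap = ℕ-Solver.solve-∀

  module _ (n ℓ : ℕ) (ℓ≤n : ℓ ≤ n) where
    private
      N r : ℕ
      N = n ∸ ℓ
      r = suc (suc (double ℓ))
      ℓ+N≡n : ℓ ℕ.+ N ≡ n
      ℓ+N≡n = ℕ.m+[n∸m]≡n ℓ≤n
      summand : ℕ → ℤ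
      summand j = + a * (δ ^ j * β ^ (n ∸ j) * + cpowCoeff r j (N ∸ j))

      ∑summand≡ : ∑ (suc N) summand ≡ + a * (β ^ ℓ * expansion r N)
      ∑summand≡ = begin
        ∑ (suc N) summand
          ≡⟨ ∑-cong (suc N) summand≡ ⟩
        ∑ (suc N) (λ j → (+ a * β ^ ℓ) * (δ ^ j * β ^ (N ∸ j) * + cpowCoeff r j (N ∸ j)))
          ≡⟨ *-distribˡ-∑ (suc N) (+ a * β ^ ℓ) (λ j → δ ^ j * β ^ (N ∸ j) * + cpowCoeff r j (N ∸ j)) ⟨
        (+ a * β ^ ℓ) * expansion r N
          ≡⟨ ℤ.*-assoc (+ a) (β ^ ℓ) (expansion r N) ⟩
        + a * (β ^ ℓ * expansion r N)
          ∎
        where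
        regroup : ∀ a x y q w → a * (x * (y * q) * w) ≡ (a * y) * (x * q * w)
        regroup = solve-∀
        summand≡ : ∀ j → j < suc N → summand j ≡ (+ a * β ^ ℓ) * (δ ^ j * β ^ (N ∸ j) * + cpowCoeff r j (N ∸ j))
        summand≡ j (s≤s j≤N) = begin
          + a * (δ ^ j * β ^ (n ∸ j) * c)
            ≡⟨ cong (λ z → + a * (δ ^ j * β ^ z * c)) (trans (cong (_∸ j) (sym ℓ+N≡n)) (ℕ.+-∸-assoc ℓ j≤N)) ⟩
          + a * (δ ^ j * β ^ (ℓ ℕ.+ (N ∸ j)) * c)
            ≡⟨ cong (λ z → + a * (δ ^ j * z * c)) (ℤ.^-distribˡ-+-* β ℓ (N ∸ j)) ⟩
          + a * (δ ^ j * (β ^ ℓ * β ^ (N ∸ j)) * c)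
            ≡⟨ regroup (+ a) (δ ^ j) (β ^ ℓ) (β ^ (N ∸ j)) c ⟩
          (+ a * β ^ ℓ) * (δ ^ j * β ^ (N ∸ j) * c)
            ∎
          where
          c : ℤ
          c = + cpowCoeff r j (N ∸ j)

      formulaTerm≡summand : ∀ j → j < suc N → formulaTerm a b n ℓ j ≡ summand j / 1
      formulaTerm≡summand j (s≤s j≤N) = trans (cong (_/ M) numerator≡) (*-/-cancelˡ (suc (2 ℕ.* n ∸ j)) (summand j))
        where
        m M : ℕ
        m = N ∸ j
        M = suc (suc (2 ℕ.* n ∸ j))
        N≡j+m : N ≡ j ℕ.+ m
        N≡j+m = sym (ℕ.m+[n∸m]≡n j≤N)
        arith : ∀ l j m → 2 ℕ.* (l ℕ.+ (j ℕ.+ m)) ≡ (l ℕ.+ l ℕ.+ (j ℕ.+ (m ℕ.+ m))) ℕ.+ j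
        arith = ℕ-Solver.solve-∀
        M≡ : M ≡ r ℕ.+ (j ℕ.+ (m ℕ.+ m))
        M≡ = cong (λ z → suc (suc z)) (begin
          2 ℕ.* n ∸ j                                      ≡⟨ cong (λ z → 2 ℕ.* z ∸ j) (trans (sym ℓ+N≡n) (cong (ℓ ℕ.+_) N≡j+m)) ⟩
          2 ℕ.* (ℓ ℕ.+ (j ℕ.+ m)) ∸ j                      ≡⟨ cong (_∸ j) (arith ℓ j m) ⟩
          (ℓ ℕ.+ ℓ ℕ.+ (j ℕ.+ (m ℕ.+ m))) ℕ.+ j ∸ j        ≡⟨ ℕ.m+n∸n≡m _ j ⟩
          ℓ ℕ.+ ℓ ℕ.+ (j ℕ.+ (m ℕ.+ m))                    ≡⟨ cong (ℕ._+ (j ℕ.+ (m ℕ.+ m))) (sym (double≡+ ℓ)) ⟩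
          double ℓ ℕ.+ (j ℕ.+ (m ℕ.+ m))                   ∎)
        pos-*₃ : ∀ A X Y sj B → + A * + X * + Y * sj * B ≡ + (A ℕ.* X ℕ.* Y) * sj * B
        pos-*₃ A X Y sj B = cong (λ z → z * sj * B) (sym (trans (ℤ.pos-* (A ℕ.* X) Y) (cong (_* + Y) (ℤ.pos-* A X))))
        regroup : ∀ Mz az gz sj B → Mz * (az * gz) * sj * B ≡ Mz * (az * (sj * B * gz))
        regroup = solve-∀
        numerator≡ : + (2 ℕ.* a ℕ.* suc ℓ) * + (M C N) * + (N C j) * δ ^ j * β ^ (n ∸ j) ≡ + M * summand j
        numerator≡ = begin
          + (2 ℕ.* a ℕ.* suc ℓ) * + (M C N) * + (N C j) * δ ^ j * β ^ (n ∸ j)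
            ≡⟨ pos-*₃ (2 ℕ.* a ℕ.* suc ℓ) (M C N) (N C j) (δ ^ j) (β ^ (n ∸ j)) ⟩
          + (2 ℕ.* a ℕ.* suc ℓ ℕ.* (M C N) ℕ.* (N C j)) * δ ^ j * β ^ (n ∸ j)
            ≡⟨ cong (λ z → + z * δ ^ j * β ^ (n ∸ j)) (weighted-binomials ℓ j m M N M≡ N≡j+m) ⟩
          + (M ℕ.* (a ℕ.* cpowCoeff r j m)) * δ ^ j * β ^ (n ∸ j)
            ≡⟨ cong (λ z → z * δ ^ j * β ^ (n ∸ j)) (trans (ℤ.pos-* M (a ℕ.* cpowCoeff r j m)) (cong (+ M *_) (ℤ.pos-* a (cpowCoeff r j m)))) ⟩
          + M * (+ a * + cpowCoeff r j m) * δ ^ j * β ^ (n ∸ j)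
            ≡⟨ regroup (+ M) (+ a) (+ cpowCoeff r j m) (δ ^ j) (β ^ (n ∸ j)) ⟩
          + M * summand j
            ∎

    formula≡expansion : formula a b n ℓ ≡ (+ a * (β ^ ℓ * expansion (suc (suc (double ℓ))) (n ∸ ℓ))) / 1
    formula≡expansion = begin
      formula a b n ℓ                      ≡⟨ foldr-+-/1 (suc N) (λ i → i) (formulaTerm a b n ℓ) summand formulaTerm≡summand ⟩
      ∑ (suc N) summand / 1                ≡⟨ cong (_/ 1) ∑summand≡ ⟩
      (+ a * (β ^ ℓ * expansion r N)) / 1  ∎

  formula≡cpow : ∀ n ℓ → ℓ ≤ n → formula a b n ℓ ≡ (+ a * (β ^ ℓ * cpow (suc (suc (double ℓ))) (double (n ∸ ℓ)))) / 1
  formula≡cpow n ℓ ℓ≤n = trans (formula≡expansion n ℓ ℓ≤n)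
    (cong (λ z → (+ a * (β ^ ℓ * z)) / 1) (sym (cpow≡expansion (suc (suc (double ℓ))) (n ∸ ℓ))))

open import Data.Integer using (+_)
import Data.Integer.Properties as ℤ
open import Data.Rational using (_/_)
open import Data.Product using (_×_; _,_)
open Coefficients using (riordanEntry≡cpow)
open PeakClosedForm using (total-peaks≡cpow)
open ExplicitFormula using (formula≡cpow)

theorem7p3 : (a b : ℕ) → 1 ≤ a → 1 ≤ b →
    ((n ℓ : ℕ) → ℓ ≤ n → (+ p a b n ℓ) / 1 ≡ formula a b n ℓ)
    × (p a b 0 0 ≡ a)
    × ((C : Series) → IsCab a b C → (n ℓ : ℕ) → ℓ ≤ n →
         + p a b n ℓ ≡ riordanEntry (scale (+ a) (C ⊛ C)) (scale (+ b) (xS (C ⊛ C))) n ℓ)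
theorem7p3 a b _ _ =
    (λ n ℓ ℓ≤n → trans (cong (_/ 1) (total-peaks≡cpow a b ℓ n ℓ≤n)) (sym (formula≡cpow a b n ℓ ℓ≤n)))
  , ℤ.+-injective (trans (total-peaks≡cpow a b 0 0 z≤n) (ℤ.*-identityʳ (+ a)))
  , (λ C isC n ℓ ℓ≤n → trans (total-peaks≡cpow a b ℓ n ℓ≤n) (sym (riordanEntry≡cpow a b C isC n ℓ ℓ≤n)))
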